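{- Let $\lambda$ be a shape, let $c$ be a SE-corner of $\lambda$, and suppose the point $v$ one step North-West of $c$ (i.e. $v=c+(-1,1)$) is an interior vertex of $\lambda$. Let $\Gamma_0,\Gamma_1,\dots,\Gamma_l$ be the sequence of simplicial complexes constructed below. Then $\Gamma_l=\widetilde{\Delta}^{NK}(\lambda)$, as simplicial complexes on the set of paths supported by $\lambda$. Construction: Every path supported by $\lambda\setminus c$ extends uniquely to a path supported by $\lambda$ containing it as a contiguous piece and not turning at $v$; via this extension, regard the vertices of $\widetilde{\Delta}^{NK}(\lambda\setminus c)$ as paths supported by $\lambda$. Let $q_W$ (resp. $q_N$) be the path supported by $\lambda$ whose only turn is at $v$ and which enters $v$ from the West (resp. North). Let $\Gamma_0$ be the suspension of $\widetilde{\Delta}^{NK}(\lambda\setminus c)$ with new vertices $q_W,q_N$, i.e. the complex with faces $G$, $G\cup\{q_W\}$, $G\cup\{q_N\}$ for $G\in\widetilde{\Delta}^{NK}(\lambda\setminus c)$. Let $e_W$ be the horizontal edge from $v+(-1,0)$ to $v$ and $e_N$ the vertical edge from $v+(0,1)$ to $v$. Let $p_1,\dots,p_k$ be the paths supported by $\lambda$, distinct from $q_W$, that turn at $v$ and contain $e_W$, listed so that $p_i\prec_{e_W}p_j$ whenever $i<j\le k$; let $p_{k+1},\dots,p_l$ be the paths, distinct from $q_N$, that turn at $v$ and contain $e_N$, listed so that $p_i\succ_{e_N}p_j$ whenever $k<i<j$. For each $i$, let $r_i$ be the path that agrees with $p_i$ except that it continues straight through $v$ instead of turning there. For $1\le i\le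 k$ set $\Gamma_i=\mathrm{st}_{\{r_i,q_W\}}(\Gamma_{i-1})$, and for $k<i\le l$ set $\Gamma_i=\mathrm{st}_{\{r_i,q_N\}}(\Gamma_{i-1})$, where in both cases the new vertex is labelled $p_i$.
   Context: A shape is a finite induced subgraph $\lambda$ of the square grid graph on $\mathbb{Z}\times\mathbb{Z}$; North means increasing second coordinate, East increasing first coordinate; $\lambda\setminus c$ is the induced subgraph with vertex $c$ removed (again a shape). A vertex $v$ of $\lambda$ is interior if all nine points $v+(a,b)$, $a,b\in\{ -1,0,1\}$, are vertices of $\lambda$; otherwise boundary. A vertex $c$ of $\lambda$ is a SE-corner if neither $c+(0,-1)$ nor $c+(1,0)$ is a vertex of $\lambda$. A path supported by $\lambda$ is a sequence $v_0,\dots,v_t$ ($t\ge1$) of vertices of $\lambda$ with $v_0,v_t$ boundary, $v_1,\dots,v_{t-1}$ interior, each $v_i$ one step South or East of $v_{i-1}$. A path enters $v_i$ from the North (West) if $v_{i-1}$ is North (West) of $v_i$, leaves $v_i$ to the South (East) if $v_{i+1}$ is South (East) of $v_i$, and turns at $v_i$ if it enters from the West and leaves to the South or enters from the North and leaves to the East. $p[v,v']$ is the contiguous part of $p$ from $v$ to $v'$. Two paths $p_1,p_2$ are kissing if, for some ordering of them, they share vertices $v,v'$ with $p_1[v,v']=p_2[v,v']$, $p_1$ enters $v$ from the West and leaves $v'$ to the South, and $p_2$ enters $v$ from the North and leaves $v'$ to the East. A path is horizontal (vertical) if all its steps are East (South). The reduced non-kissing complex $\widetilde{\Delta}^{NK}(\lambda)$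 has as vertices the paths supported by $\lambda$ that are neither horizontal nor vertical, and as faces the sets of pairwise non-kissing such paths. For an edge $e$ and distinct non-kissing paths $p_1,p_2$ containing $e$, let $p_1[u,u']=p_2[u,u']$ be their maximal common contiguous subpath containing $e$; $p_1\prec_e p_2$ if $p_1$ enters $u$ from the North or leaves $u'$ to the South. For a simplicial complex $\Gamma$ and face $F$, the link is $\mathrm{lk}\,F=\{G\in\Gamma: G\cap F=\emptyset,\ G\cup F\in\Gamma\}$, and the stellation of $\Gamma$ at $F$ with new vertex $x$ is $\mathrm{st}_F(\Gamma)=\{G\in\Gamma: F\not\subseteq G\}\cup\{G\cup H\cup\{x\}: G\in\mathrm{lk}\,F,\ H\subsetneq F\}$. -}

module Defs where

open import Data.Integer using (ℤ; _+_; 0ℤ; 1ℤ; -1ℤ)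
import Data.Integer as ℤ
open import Data.Product using (Σ; ∃; ∃-syntax; _×_; _,_; proj₁; proj₂)
open import Data.Product.Properties using (≡-dec)
open import Data.Sum using (_⊎_)
open import Data.List using (List; []; _∷_; _++_; _∷ʳ_; filter; foldl; map)
open import Data.List.Membership.Propositional using (_∈_; _∉_)
open import Data.List.Relation.Binary.Subset.Propositional using (_⊆_)
open import Data.List.Relation.Unary.All using (All)
open import Data.List.Relation.Unary.AllPairs using (AllPairs)
open import Data.List.Relation.Unary.Unique.Propositional using (Unique)
open import Relation.Binary.PropositionalEquality using (_≡_; _≢_)
open import Relation.Nullary using (¬_; ¬?)
open import Function.Bundles using (_⇔_)

-- Points of ℤ × ℤ (first coordinate: East, second coordinate: North)

Point : Set
Point = ℤ × ℤ

_+P_ : Point → Point → Point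
(x , y) +P (a , b) = (x + a , y + b)

_≟P_ : (p q : Point) → Relation.Nullary.Dec (p ≡ q)
_≟P_ = ≡-dec ℤ._≟_ ℤ._≟_

-- A shape: the finite vertex set of an induced subgraph of the grid
-- (the induced subgraph is determined by its vertex set).
Shape : Set
Shape = List Point

_∖_ : Shape → Point → Shape
Λ ∖ c = filter (λ x → ¬? (x ≟P c)) Λ

offsets : List ℤ
offsets = -1ℤ ∷ 0ℤ ∷ 1ℤ ∷ []

Interior : Shape → Point → Set
Interior Λ v = ∀ a b → a ∈ offsets → b ∈ offsets → (v +P (a , b)) ∈ Λ

Boundary : Shape → Point → Set
Boundary Λ v = v ∈ Λ × ¬ Interior Λ v

SECorner : Shape → Point → Set
SECorner Λ c = c ∈ Λ × (c +P (0ℤ , -1ℤ)) ∉ Λ × (c +P (1ℤ , 0ℤ)) ∉ Λ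

northWest : Point → Point
northWest c = c +P (-1ℤ , 1ℤ)

-- Paths: a start vertex and a list of steps, each South or East

data Dir : Set where
  E S : Dir

move : Point → Dir → Point
move p E = p +P (1ℤ , 0ℤ)
move p S = p +P (0ℤ , -1ℤ)

walk : Point → List Dir → Point
walk p []       = p
walk p (d ∷ ds) = walk (move p d) ds

record Path : Set where
  constructor mkPath
  field
    start : Point
    steps : List Dir
open Path public

-- p = v_0,…,v_t is supported by Λ: t ≥ 1, v_0 and v_t boundary,
-- v_1,…,v_{t-1} interior
Supported : Shape → Path → Set
Supported Λ p =
  steps p ≢ []
  × Boundary Λ (start p)
  × Boundary Λ (walk (start p) (steps p))
  × (∀ a d b → steps p ≡ a ++ d ∷ b → a ≢ [] → Interior Λ (walk (start p) a))

Horizontal : Path → Set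
Horizontal p = All (_≡ E) (steps p)

Vertical : Path → Set
Vertical p = All (_≡ S) (steps p)

-- p₁ enters v from the West, p₂ enters v from the North, they agree from
-- v to v', p₁ leaves v' to the South and p₂ leaves v' to the East.
Kiss₁ : Path → Path → Set
Kiss₁ p₁ p₂ = ∃[ a₁ ] ∃[ b₁ ] ∃[ a₂ ] ∃[ b₂ ] ∃[ m ]
  ( steps p₁ ≡ a₁ ++ E ∷ (m ++ S ∷ b₁)
  × steps p₂ ≡ a₂ ++ S ∷ (m ++ E ∷ b₂)
  × walk (start p₁) (a₁ ∷ʳ E) ≡ walk (start p₂) (a₂ ∷ʳ S) )

Kissing : Path → Path → Set
Kissing p q = Kiss₁ p q ⊎ Kiss₁ q p

-- Simplicial complexes on paths: predicates on finite sets of paths,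
-- finite sets being represented by lists (all constructions below only
-- depend on the membership relation of the list).

Face : Set
Face = List Path

Complex : Set₁
Complex = Face → Set

_≋_ : Face → Face → Set
K ≋ L = ∀ x → (x ∈ K ⇔ x ∈ L)

NKVertex : Shape → Path → Set
NKVertex Λ p = Supported Λ p × ¬ Horizontal p × ¬ Vertical p

NK : Shape → Complex
NK Λ K = All (NKVertex Λ) K × (∀ p q → p ∈ K → q ∈ K → ¬ Kissing p q)

Link : Complex → Face → Face → Set
Link Γ F G = Γ G × (∀ y → y ∈ G → y ∉ F) × Γ (G ++ F)

stellate : Face → Path → Complex → Complex
stellate F x Γ K =
  (Γ K × ¬ (F ⊆ K))
  ⊎ (∃[ G ] ∃[ H ] (Link Γ F G × H ⊆ F × ¬ (F ⊆ H) × K ≋ (G ++ H ++ x ∷ [])))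

TurnsAt : Point → Path → Set
TurnsAt v p = ∃[ a ] ∃[ b ]
  ( (steps p ≡ a ++ E ∷ S ∷ b × walk (start p) (a ∷ʳ E) ≡ v)
  ⊎ (steps p ≡ a ++ S ∷ E ∷ b × walk (start p) (a ∷ʳ S) ≡ v) )

-- p turns at v, entering v from direction given by the step d
-- (d = E: enters from the West; d = S: enters from the North)
TurnsAtEntering : Dir → Point → Path → Set
TurnsAtEntering E v p = ∃[ a ] ∃[ b ]
  (steps p ≡ a ++ E ∷ S ∷ b × walk (start p) (a ∷ʳ E) ≡ v)
TurnsAtEntering S v p = ∃[ a ] ∃[ b ]
  (steps p ≡ a ++ S ∷ E ∷ b × walk (start p) (a ∷ʳ S) ≡ v)

IsOnlyTurnPath : Shape → Point → Dir → Path → Set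
IsOnlyTurnPath Λ v d q =
  Supported Λ q × TurnsAtEntering d v q × (∀ w → TurnsAt w q → w ≡ v)

-- a (directed) edge: from its first point to its second
Edge : Set
Edge = Point × Point

EdgeIn : Point → List Dir → Edge → Set
EdgeIn u m (x , y) = ∃[ a ] ∃[ d ] ∃[ b ]
  (m ≡ a ++ d ∷ b × walk u a ≡ x × move x d ≡ y)

HasEdge : Path → Edge → Set
HasEdge p e = EdgeIn (start p) (steps p) e

-- p₁ ≺_e p₂: with p₁[u,u'] = p₂[u,u'] the maximal common contiguous
-- subpath containing e, p₁ enters u from the North or leaves u' to the South
Prec : Edge → Path → Path → Set
Prec e p₁ p₂ = ∃[ a₁ ] ∃[ m ] ∃[ b₁ ] ∃[ a₂ ] ∃[ b₂ ]
  ( steps p₁ ≡ a₁ ++ m ++ b₁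
  × steps p₂ ≡ a₂ ++ m ++ b₂
  × walk (start p₁) a₁ ≡ walk (start p₂) a₂
  × EdgeIn (walk (start p₁) a₁) m e
  -- maximality: cannot be extended backwards …
  × ¬ (∃[ a₁' ] ∃[ a₂' ] ∃[ d ] (a₁ ≡ a₁' ∷ʳ d × a₂ ≡ a₂' ∷ʳ d))
  -- … nor forwards
  × ¬ (∃[ d ] ∃[ b₁' ] ∃[ b₂' ] (b₁ ≡ d ∷ b₁' × b₂ ≡ d ∷ b₂'))
  × ((∃[ a₁' ] a₁ ≡ a₁' ∷ʳ S) ⊎ (∃[ b₁' ] b₁ ≡ S ∷ b₁')) )

Straightened : Point → Path → Path → Set
Straightened v p r = ∃[ a ] ∃[ d ] ∃[ d' ] ∃[ b ]
  ( steps p ≡ a ++ d ∷ d' ∷ b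
  × d ≢ d'
  × walk (start p) (a ∷ʳ d) ≡ v
  × start r ≡ start p
  × steps r ≡ a ++ d ∷ d ∷ b )

Extends : Shape → Point → Path → Path → Set
Extends Λ v q q' = Supported Λ q' × ¬ TurnsAt v q'
  × ∃[ a ] ∃[ b ] (steps q' ≡ a ++ steps q ++ b × walk (start q') a ≡ start q)

eW eN : Point → Edge
eW v = (v +P (-1ℤ , 0ℤ) , v)
eN v = (v +P (0ℤ , 1ℤ) , v)

Γ₀ : Shape → Point → Path → Path → Complex
Γ₀ Λ c qW qN K = ∃[ G ] (NK (Λ ∖ c) G × ∃[ X ]
  ((X ≡ [] ⊎ X ≡ qW ∷ [] ⊎ X ≡ qN ∷ [])
  × (∀ x → x ∈ K ⇔ ((∃[ g ] (g ∈ G × Extends Λ (northWest c) g x)) ⊎ x ∈ X))))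

-- a valid listing p₁,…,p_k (each paired with its r_i) of the paths ≠ q that
-- turn at v and contain the edge e, ordered by R
ValidListing : Shape → Point → Path → Edge → (Path → Path → Set)
             → List (Path × Path) → Set
ValidListing Λ v q e R ps =
  Unique (map proj₁ ps)
  × (∀ p → p ∈ map proj₁ ps ⇔ (Supported Λ p × p ≢ q × TurnsAt v p × HasEdge p e))
  × AllPairs R (map proj₁ ps)
  × All (λ pr → Straightened v (proj₁ pr) (proj₂ pr)) ps

Γfinal : Shape → Point → Path → Path → List (Path × Path) → List (Path × Path)
       → Complex
Γfinal Λ c qW qN psW psN =
  foldl (λ Γ pr → stellate (proj₂ pr ∷ qN ∷ []) (proj₁ pr) Γ)
    (foldl (λ Γ pr → stellate (proj₂ pr ∷ qW ∷ []) (proj₁ pr) Γ)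
      (Γ₀ Λ c qW qN) psW)
    psN

module Submission where

-- Write v for the point North-West of the corner c.
--
-- Every complex of the construction is a flag complex `Clique V R`: its
-- faces are the finite sets of V-vertices that are pairwise R-compatible.
-- The proof computes V and R for every Γ_i.
--  * `Stellation`: stellating a flag complex at an edge {r, q} with a new
--    vertex x is again a flag complex, with explicitly described V and R.
--  * `Corner`: extension along v is a bijection from the NK-vertices of
--    λ ∖ c onto the NK-vertices of λ not turning at v, preserving kissing;
--    hence Γ₀ is the flag complex on those paths together with qW and qN,
--    compatible when non-kissing.  As qW kisses exactly the straightenings
--    r_i of the West listing (and qN those of the North listing), Γ₀ is also
--    "non-kissing, or one of the exceptional pairs (q, r_i)".
--  * `Side`: the geometry of one listing, i.e. of the paths turning at v
--    through a fixed edge: among paths not turning at v, p_i kisses exactly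
--    the paths kissing r_i and the r_j with p_j before p_i; two listed paths
--    kiss iff their straightenings do.
--  * `Phase`: by induction along a listing, stellating at {r_i, q} adds p_i
--    and removes the exceptional pair (q, r_i); the order of the listing is
--    exactly what makes the link of {r_i, q} agree with the non-kissing
--    neighbours of p_i.
-- After both phases every NK-vertex of λ is present and no exceptional pair
-- remains: Γ_l is the non-kissing complex of λ.

open import Defs
open import Data.Integer as ℤ using (ℤ; 0ℤ; 1ℤ; -1ℤ)
import Data.Integer.Properties as ℤP
open import Data.Integer.Tactic.RingSolver using (solve-∀)
open import Algebra.Properties.AbelianGroup ℤP.+-0-abelianGroup using (∙-cancelˡ; ∙-cancelʳ)
open import Data.Nat using (zero; suc; _+_)
import Data.Nat.Properties as ℕP
open import Data.List using (List; []; _∷_; _++_; _∷ʳ_; length; replicate; map; filter; foldl)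
open import Data.List.Properties using (++-assoc; ∷ʳ-injective; ∷ʳ-injectiveʳ; ∷ʳ-++; ++-cancelʳ; ∷-injective; ∷-injectiveˡ; ∷-injectiveʳ; ++-identityʳ; map-++; ≡-dec)
open import Data.List.Membership.Propositional using (_∈_; _∉_)
open import Data.List.Membership.Propositional.Properties using (∈-map⁺; ∈-map⁻; ∈-++⁺ˡ; ∈-++⁺ʳ; ∈-++⁻; ∈-filter⁺; ∈-filter⁻)
open import Data.List.Relation.Unary.Any using (here; there)
open import Data.List.Relation.Unary.All using (All; []; _∷_; lookup; tabulate)
import Data.List.Relation.Unary.All as All
import Data.List.Relation.Unary.All.Properties as AllP
open import Data.List.Relation.Unary.AllPairs as AllPairs using (AllPairs)
open import Data.List.Relation.Unary.Unique.Propositional using (Unique)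
open import Data.List.Relation.Binary.Subset.Propositional using (_⊆_)
open import Data.Product using (∃-syntax; _×_; _,_; proj₁; proj₂)
open import Data.Product.Properties using (,-injectiveˡ; ,-injectiveʳ)
open import Data.Sum using (_⊎_; inj₁; inj₂)
open import Data.Empty using (⊥; ⊥-elim)
open import Relation.Nullary using (¬_; Dec; yes; no; ¬?)
open import Relation.Nullary.Decidable using (_×-dec_; _⊎-dec_)
open import Relation.Binary.PropositionalEquality
open import Function.Bundles using (_⇔_; Equivalence; mk⇔)
open import Function.Construct.Composition using (_⇔-∘_)

flip : Dir → Dir
flip E = S
flip S = E

flip-flip : ∀ d → flip (flip d) ≡ d
flip-flip E = refl
flip-flip S = refl

d≢flip : ∀ d → d ≢ flip d
d≢flip E ()
d≢flip S ()

flip≢d : ∀ d → flip d ≢ d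
flip≢d E ()
flip≢d S ()

≢⇒flip : ∀ d d' → d ≢ d' → d' ≡ flip d
≢⇒flip E E ne = ⊥-elim (ne refl)
≢⇒flip E S ne = refl
≢⇒flip S E ne = refl
≢⇒flip S S ne = ⊥-elim (ne refl)

_≟D_ : (a b : Dir) → Dec (a ≡ b)
E ≟D E = yes refl
E ≟D S = no λ ()
S ≟D E = no λ ()
S ≟D S = yes refl

snocView : ∀ {A : Set} (l : List A) → l ≡ [] ⊎ ∃[ i ] ∃[ z ] (l ≡ i ∷ʳ z)
snocView [] = inj₁ refl
snocView (x ∷ l) with snocView l
... | inj₁ refl = inj₂ ([] , x , refl)
... | inj₂ (i , z , refl) = inj₂ (x ∷ i , z , refl)

++-split-by-length : ∀ {A : Set} (a b a' b' : List A) → a ++ b ≡ a' ++ b' → length a ≡ length a' → a ≡ a' × b ≡ b'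
++-split-by-length [] b [] b' eq _ = refl , eq
++-split-by-length [] b (x ∷ a') b' eq ()
++-split-by-length (x ∷ a) b [] b' eq ()
++-split-by-length (x ∷ a) b (y ∷ a') b' eq le with ∷-injective eq
... | refl , eq' with ++-split-by-length a b a' b' eq' (ℕP.suc-injective le)
... | refl , e2 = refl , e2

snoc-split : ∀ {A : Set} (xs : List A) y ys zs w → xs ++ y ∷ ys ≡ zs ∷ʳ w →
  (ys ≡ [] × xs ≡ zs × y ≡ w) ⊎ (∃[ ys' ] (ys ≡ ys' ∷ʳ w × xs ++ y ∷ ys' ≡ zs))
snoc-split [] y ys [] w eq with ∷-injective eq
... | refl , refl = inj₁ (refl , refl , refl)
snoc-split [] y ys (z ∷ zs) w eq with ∷-injective eq
... | refl , refl = inj₂ (zs , refl , refl)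
snoc-split (x ∷ xs) y ys [] w eq with ∷-injective eq
snoc-split (x ∷ []) y ys [] w eq | _ , ()
snoc-split (x ∷ _ ∷ xs) y ys [] w eq | _ , ()
snoc-split (x ∷ xs) y ys (z ∷ zs) w eq with ∷-injective eq
... | refl , eq' with snoc-split xs y ys zs w eq'
... | inj₁ (a , refl , c) = inj₁ (a , refl , c)
... | inj₂ (ys' , a , refl) = inj₂ (ys' , a , refl)

cmp-split : ∀ {A : Set} (xs : List A) x m ys y n → xs ++ x ∷ m ≡ ys ++ y ∷ n →
  (xs ≡ ys × x ≡ y × m ≡ n)
  ⊎ (∃[ n₁ ] (xs ≡ ys ++ y ∷ n₁ × n ≡ n₁ ++ x ∷ m))
  ⊎ (∃[ m₁ ] (ys ≡ xs ++ x ∷ m₁ × m ≡ m₁ ++ y ∷ n))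
cmp-split [] x m [] y n eq with ∷-injective eq
... | refl , refl = inj₁ (refl , refl , refl)
cmp-split [] x m (z ∷ ys) y n eq with ∷-injective eq
... | refl , refl = inj₂ (inj₂ (ys , refl , refl))
cmp-split (z ∷ xs) x m [] y n eq with ∷-injective eq
... | refl , refl = inj₂ (inj₁ (xs , refl , refl))
cmp-split (z ∷ xs) x m (w ∷ ys) y n eq with ∷-injective eq
... | refl , eq' with cmp-split xs x m ys y n eq'
... | inj₁ (refl , b , c) = inj₁ (refl , b , c)
... | inj₂ (inj₁ (n₁ , refl , b)) = inj₂ (inj₁ (n₁ , refl , b))
... | inj₂ (inj₂ (m₁ , refl , b)) = inj₂ (inj₂ (m₁ , refl , b))

same-suffix : ∀ {A : Set} (xs : List A) x ys y m → xs ++ x ∷ m ≡ ys ++ y ∷ m → xs ≡ ys × x ≡ y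
same-suffix xs x ys y m eq =
  ∷ʳ-injective xs ys (++-cancelʳ m (xs ∷ʳ x) (ys ∷ʳ y)
    (trans (++-assoc xs (x ∷ []) m) (trans eq (sym (++-assoc ys (y ∷ []) m)))))

reassoc-mid : ∀ {A : Set} (a : List A) d m f b → a ++ d ∷ (m ++ f ∷ b) ≡ (a ++ d ∷ m) ++ f ∷ b
reassoc-mid a d m f b = sym (++-assoc a (d ∷ m) (f ∷ b))

snoc-snoc : ∀ {A : Set} (α : List A) x y → α ++ x ∷ y ∷ [] ≡ (α ∷ʳ x) ∷ʳ y
snoc-snoc α x y = sym (++-assoc α (x ∷ []) (y ∷ []))

reassoc-++ : ∀ {A : Set} (X : List A) x Y W → (X ++ x ∷ Y) ++ W ≡ X ++ x ∷ (Y ++ W)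
reassoc-++ X x Y W = ++-assoc X (x ∷ Y) W

reassoc-snoc : ∀ {A : Set} (a : List A) dd m f b w → ((a ++ dd ∷ m) ++ f ∷ b) ∷ʳ w ≡ a ++ dd ∷ (m ++ f ∷ (b ∷ʳ w))
reassoc-snoc (x ∷ a) dd m f b w = cong (x ∷_) (reassoc-snoc a dd m f b w)
reassoc-snoc [] dd [] f b w = refl
reassoc-snoc [] dd (x ∷ m) f b w = cong (dd ∷_) (reassoc-snoc [] x m f b w)

ne-snoc : ∀ {A : Set} (P : List A) x → P ∷ʳ x ≢ []
ne-snoc [] x ()
ne-snoc (_ ∷ _) x ()

ne-mid : ∀ {A : Set} (P : List A) x Q → P ++ x ∷ Q ≢ []
ne-mid [] x Q ()
ne-mid (_ ∷ _) x Q ()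

cons≢ : ∀ {A : Set} {x : A} {xs : List A} → x ∷ xs ≢ []
cons≢ ()

rep-++ : ∀ {A : Set} (d : A) m n → replicate (m + n) d ≡ replicate m d ++ replicate n d
rep-++ d zero n = refl
rep-++ d (suc m) n = cong (d ∷_) (rep-++ d m n)

all-rep : ∀ {A : Set} {d : A} l → All (_≡ d) l → l ≡ replicate (length l) d
all-rep [] [] = refl
all-rep (x ∷ l) (refl ∷ al) = cong (x ∷_) (all-rep l al)

rep-all : ∀ {A : Set} (d : A) n → All (_≡ d) (replicate n d)
rep-all d zero = []
rep-all d (suc n) = refl ∷ rep-all d n

runs-comparable : ∀ {A : Set} {d : A} xs ys → All (_≡ d) xs → All (_≡ d) ys →
  (∃[ ζ ] (All (_≡ d) ζ × ys ≡ ζ ++ xs)) ⊎ (∃[ ε ] (All (_≡ d) ε × xs ≡ ε ++ d ∷ ys))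
runs-comparable {d = d} xs ys ax ay with ℕP.≤-<-connex (length xs) (length ys)
... | inj₁ le with ℕP.m≤n⇒∃[o]m+o≡n le
... | k , eq = inj₁ (replicate k d , rep-all d k ,
      trans (all-rep ys ay) (trans (cong (λ z → replicate z d) (trans (sym eq) (ℕP.+-comm (length xs) k)))
        (trans (rep-++ d k (length xs)) (cong (replicate k d ++_) (sym (all-rep xs ax))))))
runs-comparable {d = d} xs ys ax ay | inj₂ lt with ℕP.m≤n⇒∃[o]m+o≡n lt
... | k , eq = inj₂ (replicate k d , rep-all d k ,
      trans (all-rep xs ax) (trans (cong (λ z → replicate z d) (trans (sym eq) (ℕP.+-comm (suc (length ys)) k)))
        (trans (rep-++ d k (suc (length ys))) (cong (λ z → replicate k d ++ d ∷ z) (sym (all-rep ys ay))))))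

lastNon : ∀ (d : Dir) l → All (_≡ d) l ⊎ ∃[ α₁ ] ∃[ δ ] (l ≡ α₁ ++ flip d ∷ δ × All (_≡ d) δ)
lastNon d [] = inj₁ []
lastNon d (x ∷ l) with lastNon d l
... | inj₂ (α₁ , δ , eq , ad) = inj₂ (x ∷ α₁ , δ , cong (x ∷_) eq , ad)
... | inj₁ al with d ≟D x
... | yes refl = inj₁ (refl ∷ al)
... | no ne = inj₂ ([] , l , cong (_∷ l) (≢⇒flip d x ne) , al)

allOrTurn : ∀ (d : Dir) l → All (_≡ d) l ⊎ ∃[ xs ] ∃[ ys ] (l ++ d ∷ [] ≡ xs ++ flip d ∷ d ∷ ys)
allOrTurn d l with lastNon d l
... | inj₁ al = inj₁ al
... | inj₂ (α₁ , [] , refl , []) = inj₂ (α₁ , [] , ++-assoc α₁ (flip d ∷ []) (d ∷ []))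
... | inj₂ (α₁ , x ∷ δ , refl , refl ∷ ad) = inj₂ (α₁ , δ ++ d ∷ [] , ++-assoc α₁ (flip d ∷ x ∷ δ) (d ∷ []))

all-mid : ∀ {A : Set} {d : A} xs y ys → All (_≡ d) (xs ++ y ∷ ys) → y ≡ d
all-mid xs y ys a with AllP.++⁻ʳ xs a
... | py ∷ _ = py

only-last : ∀ (d : Dir) αq xs ys → All (_≡ d) αq → αq ++ d ∷ flip d ∷ [] ≡ xs ++ flip d ∷ ys → ys ≡ []
only-last d αq xs ys aq eq with snoc-split xs (flip d) ys (αq ∷ʳ d) (flip d) (trans (sym eq) (snoc-snoc αq d (flip d)))
... | inj₁ (e , _ , _) = e
... | inj₂ (ys' , _ , e2) = ⊥-elim (flip≢d d (all-mid xs (flip d) ys' (subst (All (_≡ d)) (sym e2) (AllP.∷ʳ⁺ aq refl))))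

allpairs-split : ∀ {A : Set} {R : A → A → Set} xs y ys → AllPairs R (xs ++ y ∷ ys) → All (λ x → R x y) xs × All (R y) ys
allpairs-split [] y ys (h AllPairs.∷ _) = [] , h
allpairs-split (x ∷ xs) y ys (h AllPairs.∷ t) with allpairs-split xs y ys t
... | a , b = lookup h (∈-++⁺ʳ xs (here refl)) ∷ a , b

path≡ : ∀ {p q : Path} → start p ≡ start q → steps p ≡ steps q → p ≡ q
path≡ {mkPath s l} {mkPath .s .l} refl refl = refl

_≟Path_ : (p q : Path) → Dec (p ≡ q)
p ≟Path q with start p ≟P start q | ≡-dec _≟D_ (steps p) (steps q)
... | yes e1 | yes e2 = yes (path≡ e1 e2)
... | no ne | _ = no λ e → ne (cong start e)
... | _ | no ne = no λ e → ne (cong steps e)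

open import Data.List.Membership.DecPropositional _≟Path_ using (_∈?_)

-- All complexes of the construction turn out to be of this
-- form, so the theorem reduces to computing their V and R.

Clique : (Path → Set) → (Path → Path → Set) → Complex
Clique V R K = All V K × (∀ a b → a ∈ K → b ∈ K → R a b)

clique-mono : ∀ {V V₂ : Path → Set} {R R₂ : Path → Path → Set} →
  (∀ a → V a → V₂ a) → (∀ a b → V a → V b → R a b → R₂ a b) → ∀ K → Clique V R K → Clique V₂ R₂ K
clique-mono fV fR K (av , rr) = All.map (λ {a} → fV a) av ,
  λ a b am bm → fR a b (lookup av am) (lookup av bm) (rr a b am bm)

-- Stellating a flag complex at an edge F = {r, q} with a new vertex x gives
-- the flag complex in which x is joined exactly to the vertices of the
-- closed link of F (`LinkNbr`), and the edge {r, q} itself is removed.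
module Stellation (V : Path → Set) (R : Path → Path → Set) (Γ : Complex) (Γ⇔ : ∀ K → Γ K ⇔ Clique V R K)
             (r q x : Path) (Vr : V r) (Vq : V q) (¬Vx : ¬ V x) (Rrq : R r q)
             (Rsym : ∀ a b → R a b → R b a) (Rrefl : ∀ a → V a → R a a) where

  F : Face
  F = r ∷ q ∷ []

  LinkNbr : Path → Set
  LinkNbr a = a ≡ r ⊎ a ≡ q ⊎ (R a r × R a q)

  IsEdgeF : Path → Path → Set
  IsEdgeF a b = (a ≡ r × b ≡ q) ⊎ (a ≡ q × b ≡ r)

  V' : Path → Set
  V' a = V a ⊎ a ≡ x

  R' : Path → Path → Set
  R' a b = (a ≡ x × b ≡ x) ⊎ (a ≡ x × b ≢ x × LinkNbr b) ⊎ (a ≢ x × b ≡ x × LinkNbr a)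
         ⊎ (a ≢ x × b ≢ x × R a b × ¬ IsEdgeF a b)

  V≢x : ∀ a → V a → a ≢ x
  V≢x a va refl = ¬Vx va

  inF : ∀ {z} → z ∈ F → z ≡ r ⊎ z ≡ q
  inF (here e) = inj₁ e
  inF (there (here e)) = inj₂ e
  inF (there (there ()))

  F⊆ : ∀ {K} → r ∈ K → q ∈ K → F ⊆ K
  F⊆ rm qm (here refl) = rm
  F⊆ rm qm (there (here refl)) = qm
  F⊆ rm qm (there (there ()))

  R'-from-x : ∀ {a} → R' x a → a ≢ x → LinkNbr a
  R'-from-x (inj₁ (_ , e)) ne = ⊥-elim (ne e)
  R'-from-x (inj₂ (inj₁ (_ , _ , n))) ne = n
  R'-from-x (inj₂ (inj₂ (inj₁ (nx , _)))) ne = ⊥-elim (nx refl)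
  R'-from-x (inj₂ (inj₂ (inj₂ (nx , _)))) ne = ⊥-elim (nx refl)

  R'-to-x : ∀ {a} → R' a x → a ≢ x → LinkNbr a
  R'-to-x (inj₁ (e , _)) ne = ⊥-elim (ne e)
  R'-to-x (inj₂ (inj₁ (e , _))) ne = ⊥-elim (ne e)
  R'-to-x (inj₂ (inj₂ (inj₁ (_ , _ , n)))) ne = n
  R'-to-x (inj₂ (inj₂ (inj₂ (_ , nx , _)))) ne = ⊥-elim (nx refl)

  R'-old : ∀ {a b} → R' a b → a ≢ x → b ≢ x → R a b × ¬ IsEdgeF a b
  R'-old (inj₁ (e , _)) na nb = ⊥-elim (na e)
  R'-old (inj₂ (inj₁ (e , _))) na nb = ⊥-elim (na e)
  R'-old (inj₂ (inj₂ (inj₁ (_ , e , _)))) na nb = ⊥-elim (nb e)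
  R'-old (inj₂ (inj₂ (inj₂ (_ , _ , rr , np)))) na nb = rr , np

  V'-old : ∀ {a} → V' a → a ≢ x → V a
  V'-old (inj₁ v) ne = v
  V'-old (inj₂ e) ne = ⊥-elim (ne e)

  old-face⇒clique : ∀ K → Γ K → ¬ (F ⊆ K) → Clique V' R' K
  old-face⇒clique K γ nf with Equivalence.to (Γ⇔ K) γ
  ... | av , rr = All.map inj₁ av , λ a b am bm →
      inj₂ (inj₂ (inj₂ (V≢x a (lookup av am) , V≢x b (lookup av bm) , rr a b am bm ,
        λ { (inj₁ (refl , refl)) → nf (F⊆ am bm) ; (inj₂ (refl , refl)) → nf (F⊆ bm am) })))

  -- The new faces G ∪ H ∪ {x}, for G in the link of F and H ⊊ F, are
  -- cliques: x is joined to G ∪ H, which lies in the closed link of F.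
  module NewFace (K G H : Face) (lk : Link Γ F G) (H⊆F : H ⊆ F) (F⊈H : ¬ (F ⊆ H)) (K≋ : K ≋ (G ++ H ++ x ∷ [])) where

    cGF : Clique V R (G ++ F)
    cGF = Equivalence.to (Γ⇔ (G ++ F)) (proj₂ (proj₂ lk))

    cat : ∀ {a} → a ∈ K → a ∈ G ⊎ a ∈ H ⊎ a ≡ x
    cat {a} am with ∈-++⁻ G (Equivalence.to (K≋ a) am)
    ... | inj₁ g = inj₁ g
    ... | inj₂ hx with ∈-++⁻ H hx
    ... | inj₁ h = inj₂ (inj₁ h)
    ... | inj₂ (here e) = inj₂ (inj₂ e)
    ... | inj₂ (there ())

    old : Path → Set
    old a = a ∈ G ⊎ a ∈ H

    oldGF : ∀ {a} → old a → a ∈ G ++ F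
    oldGF (inj₁ g) = ∈-++⁺ˡ g
    oldGF (inj₂ h) = ∈-++⁺ʳ G (H⊆F h)

    oldV : ∀ {a} → old a → V a
    oldV o = lookup (proj₁ cGF) (oldGF o)

    vk : ∀ {a} → a ∈ K → V' a
    vk am with cat am
    ... | inj₁ g = inj₁ (oldV (inj₁ g))
    ... | inj₂ (inj₁ h) = inj₁ (oldV (inj₂ h))
    ... | inj₂ (inj₂ e) = inj₂ e

    inH : ∀ {a} → old a → a ∈ F → a ∈ H
    inH (inj₁ g) f = ⊥-elim (proj₁ (proj₂ lk) _ g f)
    inH (inj₂ h) f = h

    oldN : ∀ {b} → old b → LinkNbr b
    oldN (inj₂ h) with inF (H⊆F h)
    ... | inj₁ e = inj₁ e
    ... | inj₂ e = inj₂ (inj₁ e)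
    oldN {b} (inj₁ g) = inj₂ (inj₂ (proj₂ cGF b r (∈-++⁺ˡ g) (∈-++⁺ʳ G (here refl)) , proj₂ cGF b q (∈-++⁺ˡ g) (∈-++⁺ʳ G (there (here refl)))))

    notF : ∀ {a b} → old a → old b → a ≡ r → b ≡ q → ⊥
    notF oa ob refl refl = F⊈H λ { (here refl) → inH oa (here refl) ; (there (here refl)) → inH ob (there (here refl)) ; (there (there ())) }

    both : ∀ {a b} → old a → old b → R' a b
    both {a} {b} oa ob = inj₂ (inj₂ (inj₂ (V≢x a (oldV oa) , V≢x b (oldV ob) , proj₂ cGF a b (oldGF oa) (oldGF ob) ,
                     λ { (inj₁ (e1 , e2)) → notF oa ob e1 e2 ; (inj₂ (e1 , e2)) → notF ob oa e2 e1 })))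

    rk : ∀ a b → a ∈ K → b ∈ K → R' a b
    rk a b am bm with cat am | cat bm
    ... | inj₂ (inj₂ ea) | inj₂ (inj₂ eb) = inj₁ (ea , eb)
    ... | inj₂ (inj₂ ea) | inj₁ g = inj₂ (inj₁ (ea , V≢x b (oldV (inj₁ g)) , oldN (inj₁ g)))
    ... | inj₂ (inj₂ ea) | inj₂ (inj₁ h) = inj₂ (inj₁ (ea , V≢x b (oldV (inj₂ h)) , oldN (inj₂ h)))
    ... | inj₁ g | inj₂ (inj₂ eb) = inj₂ (inj₂ (inj₁ (V≢x a (oldV (inj₁ g)) , eb , oldN (inj₁ g))))
    ... | inj₂ (inj₁ h) | inj₂ (inj₂ eb) = inj₂ (inj₂ (inj₁ (V≢x a (oldV (inj₂ h)) , eb , oldN (inj₂ h))))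
    ... | inj₁ g | inj₁ g' = both (inj₁ g) (inj₁ g')
    ... | inj₁ g | inj₂ (inj₁ h') = both (inj₁ g) (inj₂ h')
    ... | inj₂ (inj₁ h) | inj₁ g' = both (inj₂ h) (inj₁ g')
    ... | inj₂ (inj₁ h) | inj₂ (inj₁ h') = both (inj₂ h) (inj₂ h')

  new-face⇒clique : ∀ K G H → Link Γ F G → H ⊆ F → ¬ (F ⊆ H) → K ≋ (G ++ H ++ x ∷ []) → Clique V' R' K
  new-face⇒clique K G H lk H⊆F F⊈H K≋ = tabulate vk , rk
    where open NewFace K G H lk H⊆F F⊈H K≋

  clique-without-x⇒old-face : ∀ K → Clique V' R' K → x ∉ K → Γ K × ¬ (F ⊆ K)
  clique-without-x⇒old-face K (av , rr) xn =
    Equivalence.from (Γ⇔ K) (tabulate (λ am → V'-old (lookup av am) (ne am)) ,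
      λ a b am bm → proj₁ (R'-old (rr a b am bm) (ne am) (ne bm))) ,
    λ F⊆K → proj₂ (R'-old (rr r q (F⊆K (here refl)) (F⊆K (there (here refl)))) (V≢x r Vr) (V≢x q Vq)) (inj₁ (refl , refl))
    where
    ne : ∀ {a} → a ∈ K → a ≢ x
    ne am refl = xn am

  -- A clique K through x splits as G ∪ H ∪ {x} with G = K ∖ {x, r, q} in the
  -- link of F and H = K ∩ F a proper subset of F.
  module CliqueThroughX (K : Face) (av : All V' K) (rr : ∀ a b → a ∈ K → b ∈ K → R' a b) (xm : x ∈ K) where

    Outside : Path → Set
    Outside a = ¬ (a ≡ x) × ¬ (a ≡ r) × ¬ (a ≡ q)

    Outside? : ∀ a → Dec (Outside a)
    Outside? a = ¬? (a ≟Path x) ×-dec (¬? (a ≟Path r) ×-dec ¬? (a ≟Path q))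

    OnF : Path → Set
    OnF a = a ≡ r ⊎ a ≡ q

    OnF? : ∀ a → Dec (OnF a)
    OnF? a = (a ≟Path r) ⊎-dec (a ≟Path q)

    G H : Face
    G = filter Outside? K
    H = filter OnF? K

    gK : ∀ {a} → a ∈ G → a ∈ K × Outside a
    gK = ∈-filter⁻ Outside?

    hK : ∀ {a} → a ∈ H → a ∈ K × OnF a
    hK = ∈-filter⁻ OnF?

    RG : ∀ a b → a ∈ G → b ∈ G → R a b
    RG a b am bm = proj₁ (R'-old (rr a b (proj₁ (gK am)) (proj₁ (gK bm))) (proj₁ (proj₂ (gK am))) (proj₁ (proj₂ (gK bm))))

    VG : ∀ {a} → a ∈ G → V a
    VG am = V'-old (lookup av (proj₁ (gK am))) (proj₁ (proj₂ (gK am)))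

    γG : Γ G
    γG = Equivalence.from (Γ⇔ G) (tabulate VG , RG)

    disj : ∀ y → y ∈ G → y ∉ F
    disj y ym yf with inF yf
    ... | inj₁ e = proj₁ (proj₂ (proj₂ (gK ym))) e
    ... | inj₂ e = proj₂ (proj₂ (proj₂ (gK ym))) e

    -- every vertex of G is compatible with r and q since it is joined to x
    NG : ∀ {a} → a ∈ G → R a r × R a q
    NG {a} am with R'-from-x (rr x a xm (proj₁ (gK am))) (proj₁ (proj₂ (gK am)))
    ... | inj₁ e = ⊥-elim (proj₁ (proj₂ (proj₂ (gK am))) e)
    ... | inj₂ (inj₁ e) = ⊥-elim (proj₂ (proj₂ (proj₂ (gK am))) e)
    ... | inj₂ (inj₂ rq) = rq

    catGF : ∀ {a} → a ∈ G ++ F → a ∈ G ⊎ OnF a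
    catGF {a} am with ∈-++⁻ G am
    ... | inj₁ g = inj₁ g
    ... | inj₂ f = inj₂ (inF f)

    VF : ∀ {a} → OnF a → V a
    VF (inj₁ refl) = Vr
    VF (inj₂ refl) = Vq

    RF : ∀ {a b} → OnF a → OnF b → R a b
    RF (inj₁ refl) (inj₁ refl) = Rrefl r Vr
    RF (inj₁ refl) (inj₂ refl) = Rrq
    RF (inj₂ refl) (inj₁ refl) = Rsym r q Rrq
    RF (inj₂ refl) (inj₂ refl) = Rrefl q Vq

    RGF : ∀ {a b} → a ∈ G → OnF b → R a b
    RGF am (inj₁ refl) = proj₁ (NG am)
    RGF am (inj₂ refl) = proj₂ (NG am)

    vgf : ∀ {a} → a ∈ G ++ F → V a
    vgf am with catGF am
    ... | inj₁ g = VG g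
    ... | inj₂ f = VF f

    rgf : ∀ a b → a ∈ G ++ F → b ∈ G ++ F → R a b
    rgf a b am bm with catGF am | catGF bm
    ... | inj₁ g | inj₁ g' = RG a b g g'
    ... | inj₁ g | inj₂ f = RGF g f
    ... | inj₂ f | inj₁ g = Rsym b a (RGF g f)
    ... | inj₂ f | inj₂ f' = RF f f'

    γGF : Γ (G ++ F)
    γGF = Equivalence.from (Γ⇔ (G ++ F)) (tabulate vgf , rgf)

    G-link : Link Γ F G
    G-link = γG , disj , γGF

    H⊆F : H ⊆ F
    H⊆F hm with proj₂ (hK hm)
    ... | inj₁ refl = here refl
    ... | inj₂ refl = there (here refl)

    -- r and q are not both in K, as R' forbids the edge F
    F⊈H : ¬ (F ⊆ H)
    F⊈H F⊆H = proj₂ (R'-old (rr r q (proj₁ (hK (F⊆H (here refl)))) (proj₁ (hK (F⊆H (there (here refl)))))) (V≢x r Vr) (V≢x q Vq)) (inj₁ (refl , refl))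

    K≋GHx : K ≋ (G ++ H ++ x ∷ [])
    K≋GHx z = mk⇔ t f
      where
      t : z ∈ K → z ∈ G ++ H ++ x ∷ []
      t zm with z ≟Path x
      ... | yes e = ∈-++⁺ʳ G (∈-++⁺ʳ H (here e))
      ... | no nx with OnF? z
      ... | yes ph = ∈-++⁺ʳ G (∈-++⁺ˡ (∈-filter⁺ OnF? zm ph))
      ... | no nph = ∈-++⁺ˡ (∈-filter⁺ Outside? zm (nx , (λ e → nph (inj₁ e)) , (λ e → nph (inj₂ e))))
      f : z ∈ G ++ H ++ x ∷ [] → z ∈ K
      f zm with ∈-++⁻ G zm
      ... | inj₁ g = proj₁ (gK g)
      ... | inj₂ hx with ∈-++⁻ H hx
      ... | inj₁ h = proj₁ (hK h)
      ... | inj₂ (here refl) = xm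
      ... | inj₂ (there ())

  stellate⇔Clique : ∀ K → stellate F x Γ K ⇔ Clique V' R' K
  stellate⇔Clique K = mk⇔ to from
    where
    to : stellate F x Γ K → Clique V' R' K
    to (inj₁ (γ , nf)) = old-face⇒clique K γ nf
    to (inj₂ (G , H , lk , H⊆F , nF⊆H , K≋)) = new-face⇒clique K G H lk H⊆F nF⊆H K≋
    from : Clique V' R' K → stellate F x Γ K
    from (av , rr) with x ∈? K
    ... | no xn = inj₁ (clique-without-x⇒old-face K (av , rr) xn)
    ... | yes xm = inj₂ (G , H , G-link , H⊆F , F⊈H , K≋GHx)
      where open CliqueThroughX K av rr xm

-- The quantity x - y grows by one with every step, so
-- a walk's length is determined by its endpoints; in particular two prefixes
-- of one step list reaching the same point coincide (`align`).

walk-++ : ∀ s a b → walk s (a ++ b) ≡ walk (walk s a) b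
walk-++ s [] b = refl
walk-++ s (x ∷ a) b = walk-++ (move s x) a b

walk-∷ʳ : ∀ s a d → walk s (a ∷ʳ d) ≡ move (walk s a) d
walk-∷ʳ s a d = walk-++ s a (d ∷ [])

walk-mid : ∀ s (a : List Dir) d m → walk s (a ++ d ∷ m) ≡ walk (walk s (a ∷ʳ d)) m
walk-mid s a d m = trans (cong (walk s) (sym (++-assoc a (d ∷ []) m))) (walk-++ s (a ∷ʳ d) m)

diag : Point → ℤ
diag (x , y) = x ℤ.- y

diag-move : ∀ p d → diag (move p d) ≡ diag p ℤ.+ 1ℤ
diag-move (x , y) E = l1 x y
  where
  l1 : ∀ x y → (x ℤ.+ 1ℤ) ℤ.- (y ℤ.+ 0ℤ) ≡ (x ℤ.- y) ℤ.+ 1ℤ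
  l1 = solve-∀
diag-move (x , y) S = l2 x y
  where
  l2 : ∀ x y → (x ℤ.+ 0ℤ) ℤ.- (y ℤ.+ -1ℤ) ≡ (x ℤ.- y) ℤ.+ 1ℤ
  l2 = solve-∀

diag-walk : ∀ s a → diag (walk s a) ≡ diag s ℤ.+ ℤ.+ (length a)
diag-walk s [] = sym (ℤP.+-identityʳ (diag s))
diag-walk s (x ∷ a) = begin
    diag (walk (move s x) a) ≡⟨ diag-walk (move s x) a ⟩
    diag (move s x) ℤ.+ ℤ.+ length a ≡⟨ cong (λ z → z ℤ.+ ℤ.+ length a) (diag-move s x) ⟩
    diag s ℤ.+ 1ℤ ℤ.+ ℤ.+ length a ≡⟨ ℤP.+-assoc (diag s) 1ℤ (ℤ.+ length a) ⟩
    diag s ℤ.+ (1ℤ ℤ.+ ℤ.+ length a) ≡⟨ cong (λ z → diag s ℤ.+ z) (ℤP.pos-+ 1 (length a)) ⟨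
    diag s ℤ.+ ℤ.+ (length (x ∷ a)) ∎
  where open ≡-Reasoning

walk-length : ∀ s a a' → walk s a ≡ walk s a' → length a ≡ length a'
walk-length s a a' eq = ℤP.+-injective (∙-cancelˡ (diag s) _ _ (trans (sym (diag-walk s a)) (trans (cong diag eq) (diag-walk s a'))))

align : ∀ s (l a b a' b' : List Dir) → l ≡ a ++ b → l ≡ a' ++ b' → walk s a ≡ walk s a' → a ≡ a' × b ≡ b'
align s l a b a' b' e1 e2 w = ++-split-by-length a b a' b' (trans (sym e1) e2) (walk-length s a a' w)

+P-assoc : ∀ w a b e f → (w +P (a , b)) +P (e , f) ≡ w +P (a ℤ.+ e , b ℤ.+ f)
+P-assoc (x , y) a b e f = cong₂ _,_ (ℤP.+-assoc x a e) (ℤP.+-assoc y b f)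

+P-zero : ∀ w → w +P (0ℤ , 0ℤ) ≡ w
+P-zero (x , y) = cong₂ _,_ (ℤP.+-identityʳ x) (ℤP.+-identityʳ y)

+P-cancel : ∀ w w' o → w +P o ≡ w' +P o → w ≡ w'
+P-cancel (x , y) (x' , y') (a , b) eq =
  cong₂ _,_ (∙-cancelʳ a x x' (,-injectiveˡ eq)) (∙-cancelʳ b y y' (,-injectiveʳ eq))

+P-inv : ∀ w a b e f → a ℤ.+ e ≡ 0ℤ → b ℤ.+ f ≡ 0ℤ → (w +P (a , b)) +P (e , f) ≡ w
+P-inv w a b e f p q = trans (+P-assoc w a b e f) (trans (cong₂ (λ s t → w +P (s , t)) p q) (+P-zero w))

move-inj : ∀ p p' d → move p d ≡ move p' d → p ≡ p'
move-inj p p' E eq = +P-cancel p p' _ eq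
move-inj p p' S eq = +P-cancel p p' _ eq

walk-inj : ∀ s s' l → walk s l ≡ walk s' l → s ≡ s'
walk-inj s s' [] eq = eq
walk-inj s s' (x ∷ l) eq = move-inj s s' x (walk-inj (move s x) (move s' x) l eq)

-1∈offsets : -1ℤ ∈ offsets
-1∈offsets = here refl

0∈offsets : 0ℤ ∈ offsets
0∈offsets = there (here refl)

1∈offsets : 1ℤ ∈ offsets
1∈offsets = there (there (here refl))

-1≢0 : -1ℤ ≢ 0ℤ
-1≢0 ()

1≢0 : 1ℤ ≢ 0ℤ
1≢0 ()

interior⇒∈ : ∀ {Λ w} → Interior Λ w → w ∈ Λ
interior⇒∈ {Λ} {w} I = subst (_∈ Λ) (+P-zero w) (I 0ℤ 0ℤ 0∈offsets 0∈offsets)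

edgeInto : Dir → Point → Edge
edgeInto E = eW
edgeInto S = eN

edgeInto-target : ∀ d w → proj₂ (edgeInto d w) ≡ w
edgeInto-target E w = refl
edgeInto-target S w = refl

-- Kissing in a given direction: `Kd d p₁ p₂` says that p₁ enters the
-- common part by a step d and leaves it by flip d, while p₂ enters by flip d
-- and leaves by d.  `Kissing` is `Kd E` in either order.
Kd : Dir → Path → Path → Set
Kd d p₁ p₂ = ∃[ a₁ ] ∃[ b₁ ] ∃[ a₂ ] ∃[ b₂ ] ∃[ m ]
  ( steps p₁ ≡ a₁ ++ d ∷ (m ++ flip d ∷ b₁)
  × steps p₂ ≡ a₂ ++ flip d ∷ (m ++ d ∷ b₂)
  × walk (start p₁) (a₁ ∷ʳ d) ≡ walk (start p₂) (a₂ ∷ʳ flip d) )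

Kd-sym : ∀ d p q → Kd d p q → Kd (flip d) q p
Kd-sym E p q (a₁ , b₁ , a₂ , b₂ , m , e1 , e2 , w) = a₂ , b₂ , a₁ , b₁ , m , e2 , e1 , sym w
Kd-sym S p q (a₁ , b₁ , a₂ , b₂ , m , e1 , e2 , w) = a₂ , b₂ , a₁ , b₁ , m , e2 , e1 , sym w

Kissing-sym : ∀ p q → Kissing p q → Kissing q p
Kissing-sym p q (inj₁ k) = inj₂ k
Kissing-sym p q (inj₂ k) = inj₁ k

kiss-intro : ∀ d p q → Kd d p q → Kissing p q
kiss-intro E p q k = inj₁ k
kiss-intro S p q k = inj₂ (Kd-sym S p q k)

kiss-elim : ∀ d p q → Kissing p q → Kd d p q ⊎ Kd (flip d) p q
kiss-elim E p q (inj₁ k) = inj₁ k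
kiss-elim E p q (inj₂ k) = inj₂ (Kd-sym E q p k)
kiss-elim S p q (inj₁ k) = inj₂ k
kiss-elim S p q (inj₂ k) = inj₁ (Kd-sym E q p k)

kiss-elim-swap : ∀ d p q → Kissing p q → Kd d p q ⊎ Kd d q p
kiss-elim-swap E p q (inj₁ k) = inj₁ k
kiss-elim-swap E p q (inj₂ k) = inj₂ k
kiss-elim-swap S p q (inj₁ k) = inj₂ (Kd-sym E p q k)
kiss-elim-swap S p q (inj₂ k) = inj₁ (Kd-sym E q p k)

kiss-intro-swap : ∀ d p q → Kd d q p → Kissing p q
kiss-intro-swap d p q k = Kissing-sym q p (kiss-intro d q p k)

Kd-irrefl : ∀ d x → ¬ Kd d x x
Kd-irrefl d x (a₁ , b₁ , a₂ , b₂ , m , e1 , e2 , w) =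
  d≢flip d (∷ʳ-injectiveʳ a₁ a₂ (proj₁ (align (start x) (steps x) (a₁ ∷ʳ d) _ (a₂ ∷ʳ flip d) _
    (trans e1 (sym (++-assoc a₁ (d ∷ []) _))) (trans e2 (sym (++-assoc a₂ (flip d ∷ []) _))) w)))

Kissing-irrefl : ∀ x → ¬ Kissing x x
Kissing-irrefl x (inj₁ k) = Kd-irrefl E x k
Kissing-irrefl x (inj₂ k) = Kd-irrefl E x k

turns-intro : ∀ w y a x b → steps y ≡ a ++ x ∷ flip x ∷ b → walk (start y) (a ∷ʳ x) ≡ w → TurnsAt w y
turns-intro w y a E b e1 e2 = a , b , inj₁ (e1 , e2)
turns-intro w y a S b e1 e2 = a , b , inj₂ (e1 , e2)

turns-elim : ∀ w y → TurnsAt w y → ∃[ x ] ∃[ a ] ∃[ b ] (steps y ≡ a ++ x ∷ flip x ∷ b × walk (start y) (a ∷ʳ x) ≡ w)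
turns-elim w y (a , b , inj₁ (e1 , e2)) = E , a , b , e1 , e2
turns-elim w y (a , b , inj₂ (e1 , e2)) = S , a , b , e1 , e2

entering-elim : ∀ d w y → TurnsAtEntering d w y → ∃[ a ] ∃[ b ] (steps y ≡ a ++ d ∷ flip d ∷ b × walk (start y) (a ∷ʳ d) ≡ w)
entering-elim E w y t = t
entering-elim S w y t = t

entering-intro : ∀ d w y a b → steps y ≡ a ++ d ∷ flip d ∷ b → walk (start y) (a ∷ʳ d) ≡ w → TurnsAtEntering d w y
entering-intro E w y a b e1 e2 = a , b , e1 , e2
entering-intro S w y a b e1 e2 = a , b , e1 , e2

entering⇒turns : ∀ d w y → TurnsAtEntering d w y → TurnsAt w y
entering⇒turns d w y t with entering-elim d w y t
... | a , b , e1 , e2 = turns-intro w y a d b e1 e2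

opposite-turns-kiss : ∀ d w x y → TurnsAtEntering d w x → TurnsAtEntering (flip d) w y → Kd d x y
opposite-turns-kiss d w x y tx ty with entering-elim d w x tx | entering-elim (flip d) w y ty
... | a , b , e1 , e2 | a' , b' , e1' , e2' = a , b , a' , b' , [] , e1 , subst (λ z → steps y ≡ a' ++ flip d ∷ z ∷ b') (flip-flip d) e1' , trans e2 (sym e2')

turns-one-side : ∀ d w x → TurnsAtEntering d w x → TurnsAtEntering (flip d) w x → ⊥
turns-one-side d w x t t' with entering-elim d w x t | entering-elim (flip d) w x t'
... | a , b , e1 , e2 | a' , b' , e1' , e2' =
  d≢flip d (∷ʳ-injectiveʳ a a' (proj₁ (align (start x) (steps x) (a ∷ʳ d) _ (a' ∷ʳ flip d) _
    (trans e1 (sym (++-assoc a (d ∷ []) _))) (trans e1' (sym (++-assoc a' (flip d ∷ []) _))) (trans e2 (sym e2')))))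

Kd-append : ∀ d x₀ y₀ x y t t' → start x ≡ start x₀ → steps x ≡ steps x₀ ++ t → start y ≡ start y₀ → steps y ≡ steps y₀ ++ t' → Kd d x₀ y₀ → Kd d x y
Kd-append d x₀ y₀ x y t t' sx ex sy ey (a₁ , b₁ , a₂ , b₂ , m , e1 , e2 , w) =
  a₁ , b₁ ++ t , a₂ , b₂ ++ t' , m ,
  trans ex (trans (cong (_++ t) e1) (lem a₁ d m (flip d) b₁ t)) ,
  trans ey (trans (cong (_++ t') e2) (lem a₂ (flip d) m d b₂ t')) ,
  trans (cong (λ z → walk z (a₁ ∷ʳ d)) sx) (trans w (cong (λ z → walk z (a₂ ∷ʳ flip d)) (sym sy)))
  where
  lem : ∀ (a : List Dir) d m f b t → (a ++ d ∷ (m ++ f ∷ b)) ++ t ≡ a ++ d ∷ (m ++ f ∷ (b ++ t))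
  lem a d m f b t = trans (++-assoc a (d ∷ (m ++ f ∷ b)) t) (cong (λ z → a ++ d ∷ z) (++-assoc m (f ∷ b) t))

-- Two paths ending with the same steps d e at a common vertex: a kiss
-- between them survives changing the last step e into e', as the common
-- part of a kiss ends before that step.
Kd-change-last : ∀ dd d e e' x y x' y' α β →
    start x' ≡ start x → start y' ≡ start y →
    steps x ≡ α ++ d ∷ e ∷ [] → steps y ≡ β ++ d ∷ e ∷ [] →
    steps x' ≡ α ++ d ∷ e' ∷ [] → steps y' ≡ β ++ d ∷ e' ∷ [] →
    walk (start x) (α ∷ʳ d) ≡ walk (start y) (β ∷ʳ d) →
    Kd dd x y → Kd dd x' y'
Kd-change-last dd d e e' x y x' y' α β sx sy ex ey ex' ey' wv (a₁ , b₁ , a₂ , b₂ , m , e1 , e2 , w)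
  with snoc-split (a₁ ++ dd ∷ m) (flip dd) b₁ (α ∷ʳ d) e (trans (sym (reassoc-mid a₁ dd m (flip dd) b₁)) (trans (sym e1) (trans ex (snoc-snoc α d e))))
     | snoc-split (a₂ ++ flip dd ∷ m) dd b₂ (β ∷ʳ d) e (trans (sym (reassoc-mid a₂ (flip dd) m dd b₂)) (trans (sym e2) (trans ey (snoc-snoc β d e))))
... | inj₁ (_ , P1 , fe) | _ = ⊥-elim (d≢flip dd (trans de (sym fe)))
  where
  wy : walk (start y) (a₂ ++ flip dd ∷ m) ≡ walk (start y) (β ∷ʳ d)
  wy = trans (walk-mid (start y) a₂ (flip dd) m) (trans (cong (λ z → walk z m) (sym w)) (trans (sym (walk-mid (start x) a₁ dd m)) (trans (cong (walk (start x)) P1) wv)))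
  de : dd ≡ e
  de = ∷-injectiveˡ (proj₂ (align (start y) (steps y) (a₂ ++ flip dd ∷ m) (dd ∷ b₂) (β ∷ʳ d) (e ∷ []) (trans e2 (reassoc-mid a₂ (flip dd) m dd b₂)) (trans ey (sym (++-assoc β (d ∷ []) (e ∷ [])))) wy))
... | inj₂ _ | inj₁ (_ , P2 , de) = ⊥-elim (d≢flip dd (trans de (sym fe)))
  where
  wx : walk (start x) (a₁ ++ dd ∷ m) ≡ walk (start x) (α ∷ʳ d)
  wx = trans (walk-mid (start x) a₁ dd m) (trans (cong (λ z → walk z m) w) (trans (sym (walk-mid (start y) a₂ (flip dd) m)) (trans (cong (walk (start y)) P2) (sym wv))))
  fe : flip dd ≡ e
  fe = ∷-injectiveˡ (proj₂ (align (start x) (steps x) (a₁ ++ dd ∷ m) (flip dd ∷ b₁) (α ∷ʳ d) (e ∷ []) (trans e1 (reassoc-mid a₁ dd m (flip dd) b₁)) (trans ex (sym (++-assoc α (d ∷ []) (e ∷ [])))) wx))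
... | inj₂ (b₁' , _ , P1) | inj₂ (b₂' , _ , P2) =
  a₁ , b₁' ∷ʳ e' , a₂ , b₂' ∷ʳ e' , m ,
  trans ex' (trans (snoc-snoc α d e') (trans (cong (_∷ʳ e') (sym P1)) (reassoc-snoc a₁ dd m (flip dd) b₁' e'))) ,
  trans ey' (trans (snoc-snoc β d e') (trans (cong (_∷ʳ e') (sym P2)) (reassoc-snoc a₂ (flip dd) m dd b₂' e'))) ,
  trans (cong (λ z → walk z (a₁ ∷ʳ dd)) sx) (trans w (cong (λ z → walk z (a₂ ∷ʳ flip dd)) (sym sy)))

supported-interior : ∀ {Λ p} → Supported Λ p → ∀ a b → steps p ≡ a ++ b → a ≢ [] → b ≢ [] → Interior Λ (walk (start p) a)
supported-interior sp a [] eq ne ne' = ⊥-elim (ne' refl)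
supported-interior sp a (d ∷ b) eq ne ne' = proj₂ (proj₂ (proj₂ sp)) a d b eq ne

supported-∈ : ∀ {Λ p} → Supported Λ p → ∀ a b → steps p ≡ a ++ b → walk (start p) a ∈ Λ
supported-∈ sp [] b eq = proj₁ (proj₁ (proj₂ sp))
supported-∈ {Λ} {p} sp (x ∷ a) [] eq = subst (λ z → walk (start p) z ∈ Λ) (trans eq (++-identityʳ _)) (proj₁ (proj₁ (proj₂ (proj₂ sp))))
supported-∈ sp (x ∷ a) (d ∷ b) eq = interior⇒∈ (proj₂ (proj₂ (proj₂ sp)) (x ∷ a) d b eq (λ ()))

start-boundary : ∀ {Λ p} → Supported Λ p → ¬ Interior Λ (start p)
start-boundary sp = proj₂ (proj₁ (proj₂ sp))

end-boundary : ∀ {Λ p} → Supported Λ p → ¬ Interior Λ (walk (start p) (steps p))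
end-boundary sp = proj₂ (proj₁ (proj₂ (proj₂ sp)))

neither-horizontal-nor-vertical : ∀ y d → ¬ All (_≡ d) (steps y) → ¬ All (_≡ flip d) (steps y) → ¬ Horizontal y × ¬ Vertical y
neither-horizontal-nor-vertical y E a b = a , b
neither-horizontal-nor-vertical y S a b = b , a

inner-not-start : ∀ {Λ} x y P T → Supported Λ x → Supported Λ y → steps x ≡ P ++ T → P ≢ [] → T ≢ [] → start y ≡ walk (start x) P → ⊥
inner-not-start {Λ} x y P T sx sy eq pn tn st = start-boundary sy (subst (Interior Λ) (sym st) (supported-interior sx P T eq pn tn))

supported-change-last : ∀ {Λ} p r P x x' → Supported Λ p → steps p ≡ P ∷ʳ x → start r ≡ start p → steps r ≡ P ∷ʳ x'
  → walk (start p) (P ∷ʳ x') ∈ Λ → ¬ Interior Λ (walk (start p) (P ∷ʳ x')) → Supported Λ r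
supported-change-last {Λ} p r P x x' sp ep sr er m ni =
  (λ e → ne-snoc P x' (trans (sym er) e)) ,
  subst (λ z → z ∈ Λ × ¬ Interior Λ z) (sym sr) (proj₁ (proj₂ sp)) ,
  subst (λ z → z ∈ Λ × ¬ Interior Λ z) (sym (trans (cong₂ walk sr er) refl)) (m , ni) ,
  int
  where
  int : ∀ a dd b → steps r ≡ a ++ dd ∷ b → a ≢ [] → Interior Λ (walk (start r) a)
  int a dd b e an with snoc-split a dd b P x' (trans (sym e) er)
  ... | inj₁ (refl , refl , refl) = subst (λ z → Interior Λ (walk z a)) (sym sr) (supported-interior sp a (x ∷ []) ep an (λ ()))
  ... | inj₂ (b' , refl , e2) = subst (λ z → Interior Λ (walk z a)) (sym sr)
        (proj₂ (proj₂ (proj₂ sp)) a dd (b' ∷ʳ x) (trans ep (trans (cong (_∷ʳ x) (sym e2)) (++-assoc a (dd ∷ b') (x ∷ [])))) an)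

straightened-shape : ∀ {w} p r → Straightened w p r → ∀ P x y b → steps p ≡ P ++ x ∷ y ∷ b → walk (start p) (P ∷ʳ x) ≡ w
  → start r ≡ start p × steps r ≡ P ++ x ∷ x ∷ b
straightened-shape p r (a , dd , dd' , b₀ , e1 , ne , w , sr , er) P x y b ep wp
  with align (start p) (steps p) (a ∷ʳ dd) (dd' ∷ b₀) (P ∷ʳ x) (y ∷ b) (trans e1 (sym (++-assoc a (dd ∷ []) (dd' ∷ b₀)))) (trans ep (sym (++-assoc P (x ∷ []) (y ∷ b)))) (trans w (sym wp))
... | e3 , e4 with ∷ʳ-injective a P e3 | ∷-injective e4
... | refl , refl | refl , refl = sr , er

-- The two points after v are boundary, so
-- a supported path ends right after visiting v; λ ∖ c differs from Λ only in
-- that v becomes a boundary vertex.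
module Corner (Λ : Shape) (c : Point) (sec : SECorner Λ c) (vint : Interior Λ (northWest c)) where

  v : Point
  v = northWest c

  cS∉ : (c +P (0ℤ , -1ℤ)) ∉ Λ
  cS∉ = proj₁ (proj₂ sec)
  cE∉ : (c +P (1ℤ , 0ℤ)) ∉ Λ
  cE∉ = proj₂ (proj₂ sec)

  v+SE≡c : v +P (1ℤ , -1ℤ) ≡ c
  v+SE≡c = +P-inv c -1ℤ 1ℤ 1ℤ -1ℤ refl refl

  -- Both points after v are boundary: their SE neighbour lies outside Λ.
  after-v-boundary : ∀ d → ¬ Interior Λ (move v d)
  after-v-boundary E I = cE∉ (subst (_∈ Λ) eq (I 1ℤ -1ℤ 1∈offsets -1∈offsets))
    where
    eq : (move v E) +P (1ℤ , -1ℤ) ≡ c +P (1ℤ , 0ℤ)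
    eq = trans (+P-assoc v 1ℤ 0ℤ 1ℤ -1ℤ) (trans (sym (+P-assoc v 1ℤ -1ℤ 1ℤ 0ℤ)) (cong (_+P (1ℤ , 0ℤ)) v+SE≡c))
  after-v-boundary S I = cS∉ (subst (_∈ Λ) eq (I 1ℤ -1ℤ 1∈offsets -1∈offsets))
    where
    eq : (move v S) +P (1ℤ , -1ℤ) ≡ c +P (0ℤ , -1ℤ)
    eq = trans (+P-assoc v 0ℤ -1ℤ 1ℤ -1ℤ) (trans (sym (+P-assoc v 1ℤ -1ℤ 0ℤ -1ℤ)) (cong (_+P (0ℤ , -1ℤ)) v+SE≡c))

  -- No interior point is followed by c, as its SE neighbour would be
  -- South or East of c.
  interior-step≢c : ∀ w d → Interior Λ w → move w d ≢ c
  interior-step≢c w E I eq = cS∉ (subst (_∈ Λ) e2 (I 1ℤ -1ℤ 1∈offsets -1∈offsets))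
    where
    e2 : w +P (1ℤ , -1ℤ) ≡ c +P (0ℤ , -1ℤ)
    e2 = trans (sym (+P-assoc w 1ℤ 0ℤ 0ℤ -1ℤ)) (cong (_+P (0ℤ , -1ℤ)) eq)
  interior-step≢c w S I eq = cE∉ (subst (_∈ Λ) e2 (I 1ℤ -1ℤ 1∈offsets -1∈offsets))
    where
    e2 : w +P (1ℤ , -1ℤ) ≡ c +P (1ℤ , 0ℤ)
    e2 = trans (sym (+P-assoc w 0ℤ -1ℤ 1ℤ 0ℤ)) (cong (_+P (1ℤ , 0ℤ)) eq)

  c-step∉ : ∀ d → move c d ∉ Λ
  c-step∉ E = cE∉
  c-step∉ S = cS∉

  v≢c : v ≢ c
  v≢c eq = lem (,-injectiveˡ eq)
    where
    lem : ∀ {x} → x ℤ.+ -1ℤ ≢ x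
    lem {x} e = -1≢0 (∙-cancelˡ x -1ℤ 0ℤ (trans e (sym (ℤP.+-identityʳ x))))

  v∈ : v ∈ Λ
  v∈ = interior⇒∈ vint

  step-into-v : ∀ w d → move w d ≡ v → w ≡ proj₁ (edgeInto d v)
  step-into-v w E eq = trans (sym (+P-inv w 1ℤ 0ℤ -1ℤ 0ℤ refl refl)) (cong (_+P (-1ℤ , 0ℤ)) eq)
  step-into-v w S eq = trans (sym (+P-inv w 0ℤ -1ℤ 0ℤ 1ℤ refl refl)) (cong (_+P (0ℤ , 1ℤ)) eq)

  edgeInto-step : ∀ d → move (proj₁ (edgeInto d v)) d ≡ v
  edgeInto-step E = +P-inv v -1ℤ 0ℤ 1ℤ 0ℤ refl refl
  edgeInto-step S = +P-inv v 0ℤ 1ℤ 0ℤ -1ℤ refl refl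

  step-into-v-dir : ∀ d d' → move (proj₁ (edgeInto d v)) d' ≡ v → d' ≡ d
  step-into-v-dir d d' eq with d ≟D d'
  ... | yes refl = refl
  ... | no ne = ⊥-elim (lem d (subst (λ z → move (proj₁ (edgeInto d v)) z ≡ v) (≢⇒flip d d' ne) eq))
    where
    lem : ∀ d → move (proj₁ (edgeInto d v)) (flip d) ≢ v
    lem E e = -1≢0 (∙-cancelˡ (proj₂ v) -1ℤ 0ℤ (trans (trans (sym (ℤP.+-assoc (proj₂ v) 0ℤ -1ℤ)) (,-injectiveʳ e)) (sym (ℤP.+-identityʳ (proj₂ v)))))
    lem S e = 1≢0 (∙-cancelˡ (proj₁ v) 1ℤ 0ℤ (trans (trans (sym (ℤP.+-assoc (proj₁ v) 0ℤ 1ℤ)) (,-injectiveˡ e)) (sym (ℤP.+-identityʳ (proj₁ v)))))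

  v-is-penultimate : ∀ {y} → Supported Λ y → ∀ pre x rest → steps y ≡ pre ++ x ∷ rest → walk (start y) pre ≡ v → rest ≡ []
  v-is-penultimate sp pre x [] eq w = refl
  v-is-penultimate {y} sp pre x (r ∷ rest) eq w = ⊥-elim (after-v-boundary x (subst (Interior Λ) e (supported-interior sp (pre ∷ʳ x) (r ∷ rest) (trans eq (sym (++-assoc pre (x ∷ []) (r ∷ rest)))) (ne-snoc pre x) (λ ()))))
    where
    e : walk (start y) (pre ∷ʳ x) ≡ move v x
    e = trans (walk-∷ʳ (start y) pre x) (cong (λ z → move z x) w)

  start≢v : ∀ {y} → Supported Λ y → start y ≢ v
  start≢v sp eq = start-boundary sp (subst (Interior Λ) (sym eq) vint)

  end≢v : ∀ {y} → Supported Λ y → walk (start y) (steps y) ≢ v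
  end≢v sp eq = end-boundary sp (subst (Interior Λ) (sym eq) vint)

  -- NK-vertices of Λ not turning at v: those coming from λ ∖ c.
  Ext : Path → Set
  Ext y = NKVertex Λ y × ¬ TurnsAt v y

  move-v∈ : ∀ d → move v d ∈ Λ
  move-v∈ E = vint 1ℤ 0ℤ 1∈offsets 0∈offsets
  move-v∈ S = vint 0ℤ -1ℤ 0∈offsets -1∈offsets

  Λc : Shape
  Λc = Λ ∖ c

  mem∖ : ∀ {w} → w ∈ Λ → w ≢ c → w ∈ Λc
  mem∖ wm ne = ∈-filter⁺ (λ x → ¬? (x ≟P c)) wm ne

  mem∖⁻ : ∀ {w} → w ∈ Λc → w ∈ Λ × w ≢ c
  mem∖⁻ = ∈-filter⁻ (λ x → ¬? (x ≟P c))

  interior∖⇒interior : ∀ {w} → Interior Λc w → Interior Λ w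
  interior∖⇒interior I a b am bm = proj₁ (mem∖⁻ (I a b am bm))

  interior⇒interior∖ : ∀ {w} → Interior Λ w → w ≢ v → Interior Λc w
  interior⇒interior∖ {w} I ne a b am bm = mem∖ (I a b am bm) (hit a b am bm)
    where
    toS : ∀ a b a' b' → a' ∈ offsets → b' ∈ offsets → (w +P (a , b)) +P (0ℤ , -1ℤ) ≡ w +P (a' , b') → w +P (a , b) ≢ c
    toS a b a' b' am' bm' eq e = cS∉ (subst (_∈ Λ) (trans (sym eq) (cong (_+P (0ℤ , -1ℤ)) e)) (I a' b' am' bm'))
    toE : ∀ a b a' b' → a' ∈ offsets → b' ∈ offsets → (w +P (a , b)) +P (1ℤ , 0ℤ) ≡ w +P (a' , b') → w +P (a , b) ≢ c
    toE a b a' b' am' bm' eq e = cE∉ (subst (_∈ Λ) (trans (sym eq) (cong (_+P (1ℤ , 0ℤ)) e)) (I a' b' am' bm'))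
    hit : ∀ a b → a ∈ offsets → b ∈ offsets → w +P (a , b) ≢ c
    hit _ _ (here refl) (here refl) = toE -1ℤ -1ℤ 0ℤ -1ℤ 0∈offsets -1∈offsets (+P-assoc w -1ℤ -1ℤ 1ℤ 0ℤ)
    hit _ _ (there (here refl)) (here refl) = toE 0ℤ -1ℤ 1ℤ -1ℤ 1∈offsets -1∈offsets (+P-assoc w 0ℤ -1ℤ 1ℤ 0ℤ)
    hit _ _ (there (there (here refl))) (here refl) e = ne (trans (sym (+P-inv w 1ℤ -1ℤ -1ℤ 1ℤ refl refl)) (cong (_+P (-1ℤ , 1ℤ)) e))
    hit _ _ (here refl) (there (here refl)) = toS -1ℤ 0ℤ -1ℤ -1ℤ -1∈offsets -1∈offsets (+P-assoc w -1ℤ 0ℤ 0ℤ -1ℤ)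
    hit _ _ (there (here refl)) (there (here refl)) = toS 0ℤ 0ℤ 0ℤ -1ℤ 0∈offsets -1∈offsets (+P-assoc w 0ℤ 0ℤ 0ℤ -1ℤ)
    hit _ _ (there (there (here refl))) (there (here refl)) = toS 1ℤ 0ℤ 1ℤ -1ℤ 1∈offsets -1∈offsets (+P-assoc w 1ℤ 0ℤ 0ℤ -1ℤ)
    hit _ _ (here refl) (there (there (here refl))) = toS -1ℤ 1ℤ -1ℤ 0ℤ -1∈offsets 0∈offsets (+P-assoc w -1ℤ 1ℤ 0ℤ -1ℤ)
    hit _ _ (there (here refl)) (there (there (here refl))) = toS 0ℤ 1ℤ 0ℤ 0ℤ 0∈offsets 0∈offsets (+P-assoc w 0ℤ 1ℤ 0ℤ -1ℤ)
    hit _ _ (there (there (here refl))) (there (there (here refl))) = toS 1ℤ 1ℤ 1ℤ 0ℤ 1∈offsets 0∈offsets (+P-assoc w 1ℤ 1ℤ 0ℤ -1ℤ)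
    hit _ _ _ (there (there (there ())))
    hit _ _ (there (there (there ()))) _

  v-bdry∖ : ¬ Interior Λc v
  v-bdry∖ I = proj₂ (mem∖⁻ (subst (_∈ Λc) v+SE≡c (I 1ℤ -1ℤ 1∈offsets -1∈offsets))) refl

  v∈∖ : v ∈ Λc
  v∈∖ = mem∖ v∈ v≢c

  -- A supported path does not start at c: both steps out of c leave Λ ...
  start≢c : ∀ {x} → Supported Λ x → start x ≢ c
  start≢c {x} sx e = go (steps x) refl
    where
    go : ∀ l → steps x ≡ l → ⊥
    go [] eq = proj₁ sx eq
    go (s₁ ∷ rest) eq = c-step∉ s₁ (subst (λ z → move z s₁ ∈ Λ) e (supported-∈ sx (s₁ ∷ []) rest eq))

  -- ... and an NK-vertex does not end at c: the step into c would come from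
  -- an interior point.
  end≢c : ∀ {x} → NKVertex Λ x → walk (start x) (steps x) ≢ c
  end≢c {x} (sx , nh , nv) e with snocView (steps x)
  ... | inj₁ eq = proj₁ sx eq
  ... | inj₂ ([] , E , eq) = nh (subst (All (_≡ E)) (sym eq) (refl ∷ []))
  ... | inj₂ ([] , S , eq) = nv (subst (All (_≡ S)) (sym eq) (refl ∷ []))
  ... | inj₂ (p₀ ∷ pre , z , eq) = interior-step≢c (walk (start x) (p₀ ∷ pre)) z (supported-interior sx (p₀ ∷ pre) (z ∷ []) eq (λ ()) (λ ()))
          (trans (sym (walk-∷ʳ (start x) (p₀ ∷ pre) z)) (trans (cong (walk (start x)) (sym eq)) e))

  -- The extension x of a path g of λ ∖ c is g itself, or g ends at v and x
  -- continues it by one more step in the same direction.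
  ExtForm : Path → Path → Set
  ExtForm g x = start x ≡ start g × ((steps x ≡ steps g) ⊎ (∃[ g₀ ] ∃[ e ] (steps g ≡ g₀ ∷ʳ e × steps x ≡ steps g ∷ʳ e × walk (start g) (steps g) ≡ v)))

  extension-shape : ∀ g x → NKVertex Λc g → Extends Λ v g x → ExtForm g x
  extension-shape g x (sg , nh , nv) (sx , nt , a , b , ex , wa) = go a b ex wa
    where
    gne : steps g ≢ []
    gne = proj₁ sg
    gb-ne : ∀ b → steps g ++ b ≢ []
    gb-ne b e = h (steps g) refl
      where
      h : ∀ l → steps g ≡ l → ⊥
      h [] eqg = gne eqg
      h (_ ∷ _) eqg = cons≢ (trans (cong (_++ b) (sym eqg)) e)
    start-v : start g ≡ v → ⊥
    start-v sv = h (steps g) refl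
      where
      h : ∀ l → steps g ≡ l → ⊥
      h [] eqg = gne eqg
      h (E ∷ []) eqg = nh (subst (All (_≡ E)) (sym eqg) (refl ∷ []))
      h (S ∷ []) eqg = nv (subst (All (_≡ S)) (sym eqg) (refl ∷ []))
      h (s₁ ∷ s₂ ∷ gs) eqg = after-v-boundary s₁ (subst (Interior Λ) (cong (λ z → move z s₁) sv) (interior∖⇒interior {move (start g) s₁} (supported-interior sg (s₁ ∷ []) (s₂ ∷ gs) eqg (λ ()) (λ ()))))
    go : ∀ a b → steps x ≡ a ++ steps g ++ b → walk (start x) a ≡ start g → ExtForm g x
    go (a₀ ∷ as) b ex wa with start g ≟P v
    ... | yes sv = ⊥-elim (start-v sv)
    ... | no nsv = ⊥-elim (proj₂ (proj₁ (proj₂ sg)) (interior⇒interior∖ (subst (Interior Λ) wa (supported-interior sx (a₀ ∷ as) (steps g ++ b) ex (λ ()) (gb-ne b))) nsv))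
    go [] b ex refl with walk (start x) (steps g) ≟P v
    go [] [] ex refl | no ne = refl , inj₁ (trans ex (++-identityʳ _))
    go [] (b₀ ∷ bs) ex refl | no ne = ⊥-elim (proj₂ (proj₁ (proj₂ (proj₂ sg))) (interior⇒interior∖ (supported-interior sx (steps g) (b₀ ∷ bs) ex gne (λ ())) ne))
    go [] [] ex refl | yes ev = ⊥-elim (end≢v sx (trans (cong (walk (start x)) (trans ex (++-identityʳ _))) ev))
    go [] (b₀ ∷ bs) ex refl | yes ev with v-is-penultimate sx (steps g) b₀ bs ex ev
    ... | refl with snocView (steps g)
    ... | inj₁ eg = ⊥-elim (gne eg)
    ... | inj₂ (g₀ , e , eg) with e ≟D b₀
    ... | yes refl = refl , inj₂ (g₀ , e , eg , ex , ev)
    ... | no ne = ⊥-elim (nt (turns-intro v x g₀ e [] (trans ex (trans (cong (_++ b₀ ∷ []) eg) (trans (++-assoc g₀ (e ∷ []) (b₀ ∷ [])) (cong (λ z → g₀ ++ e ∷ z ∷ []) (≢⇒flip e b₀ ne)))))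
              (trans (cong (walk (start x)) (sym eg)) ev)))

  ext-unique : ∀ g x z → NKVertex Λc g → Extends Λ v g x → Extends Λ v g z → x ≡ z
  ext-unique g x z ng ex ez with extension-shape g x ng ex | extension-shape g z ng ez
  ... | sx , inj₁ e1 | sz , inj₁ e2 = path≡ (trans sx (sym sz)) (trans e1 (sym e2))
  ... | sx , inj₂ (g₀ , e , eg , e1 , ev) | sz , inj₂ (g₀' , e' , eg' , e2 , _) with ∷ʳ-injective g₀ g₀' (trans (sym eg) eg')
  ... | _ , refl = path≡ (trans sx (sym sz)) (trans e1 (sym e2))
  ext-unique g x z ng ex ez | sx , inj₁ e1 | sz , inj₂ (g₀ , e , eg , e2 , ev) = ⊥-elim (end≢v (proj₁ ex) (trans (cong₂ walk sx e1) ev))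
  ext-unique g x z ng ex ez | sx , inj₂ (g₀ , e , eg , e1 , ev) | sz , inj₁ e2 = ⊥-elim (end≢v (proj₁ ez) (trans (cong₂ walk sz e2) ev))

  -- Kisses of extensions take place inside the original paths, since an
  -- extension adds no turn at v.
  kiss-truncateˡ : ∀ dd x y g → ExtForm g x → ¬ TurnsAt v y → Kd dd x y → Kd dd g y
  kiss-truncateˡ dd x y g (sx , inj₁ e) nty (a₁ , b₁ , a₂ , b₂ , m , e1 , e2 , w) =
    a₁ , b₁ , a₂ , b₂ , m , trans (sym e) e1 , e2 , trans (cong (λ s → walk s (a₁ ∷ʳ dd)) (sym sx)) w
  kiss-truncateˡ dd x y g (sx , inj₂ (g₀ , e , eg , ex , ev)) nty (a₁ , b₁ , a₂ , b₂ , m , e1 , e2 , w)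
    with snoc-split (a₁ ++ dd ∷ m) (flip dd) b₁ (steps g) e (trans (sym (reassoc-mid a₁ dd m (flip dd) b₁)) (trans (sym e1) ex))
  ... | inj₂ (b₁' , _ , P) = a₁ , b₁' , a₂ , b₂ , m , trans (sym P) (sym (reassoc-mid a₁ dd m (flip dd) b₁')) , e2 ,
          trans (cong (λ s → walk s (a₁ ∷ʳ dd)) (sym sx)) w
  ... | inj₁ (_ , P , fe) with snocView m
  ... | inj₁ refl = ⊥-elim (d≢flip dd (trans (∷ʳ-injectiveʳ a₁ g₀ (trans P eg)) (sym fe)))
  ... | inj₂ (m' , z , refl) with ∷ʳ-injective (a₁ ++ dd ∷ m') g₀ (trans (++-assoc a₁ (dd ∷ m') (z ∷ [])) (trans P eg))
  ... | _ , refl = ⊥-elim (nty (turns-intro v y (a₂ ++ flip dd ∷ m') z b₂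
          (trans e2 (trans (reassoc-mid a₂ (flip dd) (m' ∷ʳ z) dd b₂) (trans (cong (_++ dd ∷ b₂) (sym (++-assoc a₂ (flip dd ∷ m') (z ∷ []))))
            (trans (++-assoc (a₂ ++ flip dd ∷ m') (z ∷ []) (dd ∷ b₂)) (cong (λ u → (a₂ ++ flip dd ∷ m') ++ z ∷ u ∷ b₂) (trans (sym (flip-flip dd)) (cong flip fe)))))))
          wy))
    where
    wy : walk (start y) ((a₂ ++ flip dd ∷ m') ∷ʳ z) ≡ v
    wy = trans (cong (walk (start y)) (++-assoc a₂ (flip dd ∷ m') (z ∷ [])))
           (trans (walk-mid (start y) a₂ (flip dd) (m' ∷ʳ z)) (trans (cong (λ s → walk s (m' ∷ʳ z)) (sym w))
           (trans (sym (walk-mid (start x) a₁ dd (m' ∷ʳ z))) (trans (cong (walk (start x)) P) (trans (cong (λ s → walk s (steps g)) sx) ev)))))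

  kiss-truncateʳ : ∀ dd x y g → ExtForm g y → ¬ TurnsAt v x → Kd dd x y → Kd dd x g
  kiss-truncateʳ dd x y g ef ntx k = subst (λ z → Kd z x g) (flip-flip dd) (Kd-sym (flip dd) g x (kiss-truncateˡ (flip dd) y x g ef ntx (Kd-sym dd x y k)))

  kiss-extend : ∀ dd x y g g' → ExtForm g x → ExtForm g' y → Kd dd g g' → Kd dd x y
  kiss-extend dd x y g g' (sx , fx) (sy , fy) k = Kd-append dd g g' x y (tl {g} {x} fx) (tl {g'} {y} fy) sx (el {g} {x} fx) sy (el {g'} {y} fy) k
    where
    tl : ∀ {h z} → (steps z ≡ steps h) ⊎ (∃[ g₀ ] ∃[ e ] (steps h ≡ g₀ ∷ʳ e × steps z ≡ steps h ∷ʳ e × walk (start h) (steps h) ≡ v)) → List Dir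
    tl (inj₁ _) = []
    tl (inj₂ (_ , e , _)) = e ∷ []
    el : ∀ {h z} → (f : (steps z ≡ steps h) ⊎ (∃[ g₀ ] ∃[ e ] (steps h ≡ g₀ ∷ʳ e × steps z ≡ steps h ∷ʳ e × walk (start h) (steps h) ≡ v))) → steps z ≡ steps h ++ tl f
    el (inj₁ e) = trans e (sym (++-identityʳ _))
    el (inj₂ (_ , _ , _ , e , _)) = e

  bdry∖ : ∀ {w} → w ∈ Λ → ¬ Interior Λ w → w ≢ c → w ∈ Λc × ¬ Interior Λc w
  bdry∖ {w} wm ni ne = mem∖ wm ne , λ I → ni (interior∖⇒interior {w} I)

  supported-avoiding-v : ∀ x pre e → NKVertex Λ x → steps x ≡ pre ∷ʳ e → walk (start x) pre ≢ v → Supported Λc x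
  supported-avoiding-v x pre e nk@(sx , _ , _) eq ne =
    proj₁ sx ,
    bdry∖ (proj₁ (proj₁ (proj₂ sx))) (proj₂ (proj₁ (proj₂ sx))) (start≢c sx) ,
    bdry∖ (proj₁ (proj₁ (proj₂ (proj₂ sx)))) (proj₂ (proj₁ (proj₂ (proj₂ sx)))) (end≢c nk) ,
    int
    where
    int : ∀ a dd b → steps x ≡ a ++ dd ∷ b → a ≢ [] → Interior Λc (walk (start x) a)
    int a dd b ea an = interior⇒interior∖ (proj₂ (proj₂ (proj₂ sx)) a dd b ea an) nv'
      where
      nv' : walk (start x) a ≢ v
      nv' wv with v-is-penultimate sx a dd b ea wv
      ... | refl = ne (trans (cong (walk (start x)) (proj₁ (∷ʳ-injective pre a (trans (sym eq) ea)))) wv)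

  drop-last-supported : ∀ x pre e → Supported Λ x → steps x ≡ pre ∷ʳ e → walk (start x) pre ≡ v
    → Supported Λc (mkPath (start x) pre)
  drop-last-supported x pre e sx eq wv =
    pre≢[] ,
    bdry∖ (proj₁ (proj₁ (proj₂ sx))) (proj₂ (proj₁ (proj₂ sx))) (start≢c sx) ,
    subst (λ z → z ∈ Λc × ¬ Interior Λc z) (sym wv) (v∈∖ , v-bdry∖) ,
    int
    where
    pre≢[] : pre ≢ []
    pre≢[] refl = start≢v sx wv
    int : ∀ a dd b → pre ≡ a ++ dd ∷ b → a ≢ [] → Interior Λc (walk (start x) a)
    int a dd b ea an = interior⇒interior∖ (proj₂ (proj₂ (proj₂ sx)) a dd (b ∷ʳ e) (trans eq (trans (cong (_∷ʳ e) ea) (++-assoc a (dd ∷ b) (e ∷ [])))) an) nv'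
      where
      nv' : walk (start x) a ≢ v
      nv' wa = ne-snoc b e ((∷-injectiveʳ (proj₂ (align (start x) (steps x) a (dd ∷ (b ∷ʳ e)) pre (e ∷ [])
                 (trans eq (trans (cong (_∷ʳ e) ea) (++-assoc a (dd ∷ b) (e ∷ [])))) eq (trans wa (sym wv))))))

  -- Every NK-vertex of Λ not turning at v is the extension of an NK-vertex of
  -- λ ∖ c: drop the last step if it leaves v.
  restrict-to-Λ∖c : ∀ x → NKVertex Λ x → ¬ TurnsAt v x → ∃[ g ] (NKVertex Λc g × Extends Λ v g x)
  restrict-to-Λ∖c x nk@(sx , nh , nv) nt with snocView (steps x)
  ... | inj₁ eq = ⊥-elim (proj₁ sx eq)
  ... | inj₂ (pre , e , eq) with walk (start x) pre ≟P v
  ... | no ne = x , (supported-avoiding-v x pre e nk eq ne , nh , nv) , sx , nt , [] , [] , sym (++-identityʳ _) , refl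
  ... | yes wv with snocView pre
  ... | inj₁ refl = ⊥-elim (start≢v sx wv)
  ... | inj₂ (pre' , e' , refl) with e' ≟D e
  ... | no ne = ⊥-elim (nt (turns-intro v x pre' e' [] (trans eq (trans (++-assoc pre' (e' ∷ []) (e ∷ [])) (cong (λ z → pre' ++ e' ∷ z ∷ []) (≢⇒flip e' e ne)))) wv))
  ... | yes refl = mkPath (start x) (pre' ∷ʳ e) , (drop-last-supported x (pre' ∷ʳ e) e sx eq wv , nhg , nvg) , sx , nt , [] , e ∷ [] , eq , refl
    where
    -- the dropped step repeats the previous one
    nhg : ¬ All (_≡ E) (pre' ∷ʳ e)
    nhg a = nh (subst (All (_≡ E)) (sym eq) (AllP.∷ʳ⁺ a (proj₂ (AllP.∷ʳ⁻ a))))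
    nvg : ¬ All (_≡ S) (pre' ∷ʳ e)
    nvg a = nv (subst (All (_≡ S)) (sym eq) (AllP.∷ʳ⁺ a (proj₂ (AllP.∷ʳ⁻ a))))

  -- Paths of λ ∖ c do not turn at v, v being a boundary vertex of λ ∖ c.
  ¬turns-in-Λ∖c : ∀ g → Supported Λc g → ¬ TurnsAt v g
  ¬turns-in-Λ∖c g sg t with turns-elim v g t
  ... | x , a , b , e1 , e2 = v-bdry∖ (subst (Interior Λc) e2 (supported-interior sg (a ∷ʳ x) (flip x ∷ b) (trans e1 (sym (∷ʳ-++ a x _))) (ne-snoc a x) cons≢))

  ext-kiss⇒ : ∀ g g' x y → NKVertex Λc g → NKVertex Λc g' → Extends Λ v g x → Extends Λ v g' y → Kissing x y → Kissing g g'
  ext-kiss⇒ g g' x y ng ng' ex ey k with kiss-elim E x y k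
  ... | inj₁ kk = kiss-intro E g g' (kiss-truncateʳ E g y g' (extension-shape g' y ng' ey) (¬turns-in-Λ∖c g (proj₁ ng)) (kiss-truncateˡ E x y g (extension-shape g x ng ex) (proj₁ (proj₂ ey)) kk))
  ... | inj₂ kk = kiss-intro S g g' (kiss-truncateʳ S g y g' (extension-shape g' y ng' ey) (¬turns-in-Λ∖c g (proj₁ ng)) (kiss-truncateˡ S x y g (extension-shape g x ng ex) (proj₁ (proj₂ ey)) kk))

  ext-kiss⇐ : ∀ g g' x y → NKVertex Λc g → NKVertex Λc g' → Extends Λ v g x → Extends Λ v g' y → Kissing g g' → Kissing x y
  ext-kiss⇐ g g' x y ng ng' ex ey k with kiss-elim E g g' k
  ... | inj₁ kk = kiss-intro E x y (kiss-extend E x y g g' (extension-shape g x ng ex) (extension-shape g' y ng' ey) kk)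
  ... | inj₂ kk = kiss-intro S x y (kiss-extend S x y g g' (extension-shape g x ng ex) (extension-shape g' y ng' ey) kk)

  ext-NK : ∀ g x → NKVertex Λc g → Extends Λ v g x → NKVertex Λ x × ¬ TurnsAt v x
  ext-NK g x (sg , nh , nv) ex@(sx , nt , a , b , e , _) = (sx , (λ h → nh (sub h)) , (λ h → nv (sub h))) , nt
    where
    sub : ∀ {P : Dir → Set} → All P (steps x) → All P (steps g)
    sub h = AllP.++⁻ˡ (steps g) (AllP.++⁻ʳ a (subst (All _) e h))

-- Fix the direction d in which the listed paths enter v (d = E
-- for the West listing, d = S for the North one), the path q with its only
-- turn at v, and the listed pairs (p_i, r_i) of paths turning at v through
-- the edge into v by d, with their straightenings.
module Side (Λ : Shape) (c : Point) (sec : SECorner Λ c) (vint : Interior Λ (northWest c))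
          (d : Dir) (q : Path) (qok : IsOnlyTurnPath Λ (northWest c) d q)
          (ps : List (Path × Path))
          (mem : ∀ p → p ∈ map proj₁ ps ⇔ (Supported Λ p × p ≢ q × TurnsAt (northWest c) p × HasEdge p (edgeInto d (northWest c))))
          (strs : All (λ pr → Straightened (northWest c) (proj₁ pr) (proj₂ pr)) ps) where
  open Corner Λ c sec vint

  -- the direction in which listed paths leave v
  fd : Dir
  fd = flip d

  qsup : Supported Λ q
  qsup = proj₁ qok

  -- The three shape lemmas below are abstract: later proofs only use their
  -- statements, and unfolding them would only slow down type checking.

  abstract
    q-shape : ∃[ αq ] (All (_≡ d) αq × steps q ≡ αq ++ d ∷ fd ∷ [] × walk (start q) (αq ∷ʳ d) ≡ v)
    q-shape with entering-elim d v q (proj₁ (proj₂ qok))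
    ... | a , b , e1 , e2 with v-is-penultimate qsup (a ∷ʳ d) fd b (trans e1 (sym (++-assoc a (d ∷ []) (fd ∷ b)))) e2
    ... | refl with allOrTurn d a
    ... | inj₁ al = a , al , e1 , e2
    ... | inj₂ (xs , ys , eq) = ⊥-elim (flip≢d d (∷ʳ-injectiveʳ xs a (proj₁ al2)))
      where
      st : steps q ≡ xs ++ fd ∷ flip fd ∷ (ys ∷ʳ fd)
      st = trans e1 (trans (snoc-snoc a d fd) (trans (cong (_∷ʳ fd) eq) (trans (++-assoc xs (fd ∷ d ∷ ys) (fd ∷ [])) (cong (λ z → xs ++ fd ∷ z ∷ (ys ∷ʳ fd)) (sym (flip-flip d))))))
      tv : walk (start q) (xs ∷ʳ fd) ≡ v
      tv = proj₂ (proj₂ qok) _ (turns-intro _ q xs fd (ys ∷ʳ fd) st refl)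
      al2 : (xs ∷ʳ fd ≡ a ∷ʳ d) × (_≡_ {A = List Dir} (flip fd ∷ (ys ∷ʳ fd)) (fd ∷ []))
      al2 = align (start q) (steps q) (xs ∷ʳ fd) (flip fd ∷ (ys ∷ʳ fd)) (a ∷ʳ d) (fd ∷ [])
              (trans st (sym (∷ʳ-++ xs fd _))) (trans e1 (sym (++-assoc a (d ∷ []) (fd ∷ [])))) (trans tv (sym e2))

  αq : List Dir
  αq = proj₁ q-shape
  αq-all : All (_≡ d) αq
  αq-all = proj₁ (proj₂ q-shape)
  q-st : steps q ≡ αq ++ d ∷ fd ∷ []
  q-st = proj₁ (proj₂ (proj₂ q-shape))
  q-w : walk (start q) (αq ∷ʳ d) ≡ v
  q-w = proj₂ (proj₂ (proj₂ q-shape))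

  abstract
    p-shape : ∀ p → p ∈ map proj₁ ps → ∃[ α ] (steps p ≡ α ++ d ∷ fd ∷ [] × walk (start p) (α ∷ʳ d) ≡ v)
    p-shape p pm with Equivalence.to (mem p) pm
    ... | sp , _ , tp , (a' , dd , b' , e , w1 , w2) with turns-elim v p tp
    ... | x , a , b , e1 , e2 with step-into-v-dir d dd (trans w2 (edgeInto-target d v))
    ... | refl with align (start p) (steps p) (a' ∷ʳ d) b' (a ∷ʳ x) (flip x ∷ b)
                   (trans e (sym (∷ʳ-++ a' d b'))) (trans e1 (sym (∷ʳ-++ a x _)))
                   (trans (walk-∷ʳ (start p) a' d) (trans (cong (λ z → move z d) w1) (trans (edgeInto-step d) (sym e2))))
    ... | e3 , _ with ∷ʳ-injective a' a e3
    ... | refl , refl with v-is-penultimate sp (a ∷ʳ d) fd b (trans e1 (sym (∷ʳ-++ a d _))) e2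
    ... | refl = a , e1 , e2

  abstract
    pr-shape : ∀ p r → (p , r) ∈ ps → ∃[ α ] (steps p ≡ α ++ d ∷ fd ∷ [] × start r ≡ start p × steps r ≡ α ++ d ∷ d ∷ [] × walk (start p) (α ∷ʳ d) ≡ v)
    pr-shape p r m with p-shape p (∈-map⁺ proj₁ m)
    ... | α , e1 , e2 with straightened-shape p r (lookup strs m) α d fd [] e1 e2
    ... | sr , er = α , e1 , sr , er , e2

  psup : ∀ p → p ∈ map proj₁ ps → Supported Λ p
  psup p m = proj₁ (Equivalence.to (mem p) m)

  p≢q : ∀ p → p ∈ map proj₁ ps → p ≢ q
  p≢q p m = proj₁ (proj₂ (Equivalence.to (mem p) m))

  constant-run⇒q : ∀ x α → Supported Λ x → steps x ≡ α ++ d ∷ fd ∷ [] → All (_≡ d) α → walk (start x) (α ∷ʳ d) ≡ v → x ≡ q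
  constant-run⇒q x α sx ex ax wx with runs-comparable α αq ax αq-all
  ... | inj₁ ([] , _ , eq) = path≡ (walk-inj (start x) (start q) (α ∷ʳ d) (trans wx (trans (sym q-w) (cong (λ z → walk (start q) (z ∷ʳ d)) eq)))) (trans ex (trans (cong (_++ d ∷ fd ∷ []) (sym eq)) (sym q-st)))
  ... | inj₁ (z ∷ ζ , _ , eq) = ⊥-elim (inner-not-start q x (z ∷ ζ) (α ++ d ∷ fd ∷ []) qsup sx
          (trans q-st (trans (cong (_++ d ∷ fd ∷ []) eq) (++-assoc (z ∷ ζ) α _))) (λ ()) (ne-mid α d _)
          (walk-inj (start x) (walk (start q) (z ∷ ζ)) (α ∷ʳ d) (trans wx (trans (sym q-w) (trans (cong (λ w → walk (start q) (w ∷ʳ d)) eq) (trans (cong (walk (start q)) (++-assoc (z ∷ ζ) α (d ∷ []))) (walk-++ (start q) (z ∷ ζ) (α ∷ʳ d))))))))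
  ... | inj₂ (ε , _ , eq) = ⊥-elim (inner-not-start x q (ε ∷ʳ d) (αq ++ d ∷ fd ∷ []) sx qsup
          (trans ex (trans (cong (_++ d ∷ fd ∷ []) (trans eq (sym (∷ʳ-++ ε d αq)))) (++-assoc (ε ∷ʳ d) αq _))) (ne-snoc ε d) (ne-mid αq d _)
          (walk-inj (start q) (walk (start x) (ε ∷ʳ d)) (αq ∷ʳ d) (trans q-w (trans (sym wx)
             (trans (cong (λ z → walk (start x) (z ∷ʳ d)) (trans eq (sym (∷ʳ-++ ε d αq))))
               (trans (cong (walk (start x)) (++-assoc (ε ∷ʳ d) αq (d ∷ []))) (walk-++ (start x) (ε ∷ʳ d) (αq ∷ʳ d))))))))

  straightened-Ext : ∀ p r → (p , r) ∈ ps → Ext r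
  straightened-Ext p r m with pr-shape p r m
  ... | α , ep , sr , er , wp = (sr' , neither-horizontal-nor-vertical r d nd nfd) , nt
    where
    pm : p ∈ map proj₁ ps
    pm = ∈-map⁺ proj₁ m
    wend : walk (start p) ((α ∷ʳ d) ∷ʳ d) ≡ move v d
    wend = trans (walk-∷ʳ (start p) (α ∷ʳ d) d) (cong (λ z → move z d) wp)
    sr' : Supported Λ r
    sr' = supported-change-last p r (α ∷ʳ d) fd d (psup p pm) (trans ep (snoc-snoc α d fd)) sr (trans er (snoc-snoc α d d))
            (subst (_∈ Λ) (sym wend) (move-v∈ d)) (λ I → after-v-boundary d (subst (Interior Λ) wend I))
    nd : ¬ All (_≡ d) (steps r)
    nd a = p≢q p pm (constant-run⇒q p α (psup p pm) ep (AllP.++⁻ˡ α (subst (All (_≡ d)) er a)) wp)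
    nfd : ¬ All (_≡ fd) (steps r)
    nfd a = d≢flip d (all-mid α d (d ∷ []) (subst (All (_≡ fd)) er a))
    nt : ¬ TurnsAt v r
    nt t with turns-elim v r t
    ... | x , a , b , e1 , e2 with align (start r) (steps r) (a ∷ʳ x) (flip x ∷ b) (α ∷ʳ d) (d ∷ [])
             (trans e1 (sym (∷ʳ-++ a x _))) (trans er (sym (∷ʳ-++ α d _))) (trans e2 (trans (sym wp) (cong (λ z → walk z (α ∷ʳ d)) (sym sr))))
    ... | e3 , e4 with ∷ʳ-injective a α e3 | ∷-injective e4
    ... | refl , refl | e5 , _ = flip≢d d e5

  listed-NK : ∀ p → p ∈ map proj₁ ps → NKVertex Λ p
  listed-NK p m with p-shape p m
  ... | α , ep , _ = psup p m , neither-horizontal-nor-vertical p d (λ a → flip≢d d (all-mid (α ∷ʳ d) fd [] (subst (All (_≡ d)) (trans ep (snoc-snoc α d fd)) a)))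
                                    (λ a → d≢flip d (all-mid α d (fd ∷ []) (subst (All (_≡ fd)) ep a)))

  q-NK : NKVertex Λ q
  q-NK = qsup , neither-horizontal-nor-vertical q d (λ a → flip≢d d (all-mid (αq ∷ʳ d) fd [] (subst (All (_≡ d)) (trans q-st (snoc-snoc αq d fd)) a)))
                          (λ a → d≢flip d (all-mid αq d (fd ∷ []) (subst (All (_≡ fd)) q-st a)))

  listed-from-straightened : ∀ y → Ext y → ∀ a₂ m' → steps y ≡ a₂ ++ fd ∷ (m' ++ d ∷ d ∷ []) → walk (start y) ((a₂ ++ fd ∷ m') ∷ʳ d) ≡ v
    → ∃[ p' ] ((p' , y) ∈ ps × start p' ≡ start y × steps p' ≡ a₂ ++ fd ∷ (m' ++ d ∷ fd ∷ []))
  listed-from-straightened y ey a₂ m' ey' wy with ∈-map⁻ proj₁ (Equivalence.from (mem p') (sp' , ne , tp , hp))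
    where
    A : List Dir
    A = a₂ ++ fd ∷ m'
    p' : Path
    p' = mkPath (start y) (A ++ d ∷ fd ∷ [])
    eyA : steps y ≡ (A ∷ʳ d) ∷ʳ d
    eyA = trans ey' (trans (sym (++-assoc a₂ (fd ∷ m') (d ∷ d ∷ []))) (snoc-snoc A d d))
    wend : walk (start y) ((A ∷ʳ d) ∷ʳ fd) ≡ move v fd
    wend = trans (walk-∷ʳ (start y) (A ∷ʳ d) fd) (cong (λ z → move z fd) wy)
    sp' : Supported Λ p'
    sp' = supported-change-last y p' (A ∷ʳ d) d fd (proj₁ (proj₁ ey)) eyA refl (snoc-snoc A d fd)
            (subst (_∈ Λ) (sym wend) (move-v∈ fd)) (λ I → after-v-boundary fd (subst (Interior Λ) wend I))
    ne : p' ≢ q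
    ne e = ne-mid m' d _ (only-last d αq a₂ (m' ++ d ∷ fd ∷ []) αq-all
             (trans (sym q-st) (trans (cong steps (sym e)) (++-assoc a₂ (fd ∷ m') (d ∷ fd ∷ [])))))
    tp : TurnsAt v p'
    tp = turns-intro v p' A d [] refl wy
    hp : HasEdge p' (edgeInto d v)
    hp = A , d , fd ∷ [] , refl ,
         step-into-v (walk (start y) A) d (trans (sym (walk-∷ʳ (start y) A d)) wy) ,
         trans (edgeInto-step d) (sym (edgeInto-target d v))
  ... | (p'' , r'') , m , refl with straightened-shape p'' r'' (lookup strs m) (a₂ ++ fd ∷ m') d fd [] refl wy
  ... | sr , er = p'' , subst (λ z → (p'' , z) ∈ ps) (path≡ sr (trans er (trans (++-assoc a₂ (fd ∷ m') (d ∷ d ∷ [])) (sym ey')))) m ,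
        refl , ++-assoc a₂ (fd ∷ m') (d ∷ fd ∷ [])

  listed-nokiss-q : ∀ p → p ∈ map proj₁ ps → ¬ Kissing p q
  listed-nokiss-q p pm k with p-shape p pm
  ... | α , ep , wp with kiss-elim-swap d p q k
  ... | inj₁ (a₁ , b₁ , a₂ , b₂ , m , e1 , e2 , w) = ne-mid m d b₂ (only-last d αq a₂ _ αq-all (trans (sym q-st) e2))
  ... | inj₂ (a₁ , b₁ , a₂ , b₂ , m , e1 , e2 , w)
      with snoc-split (a₁ ++ d ∷ m) fd b₁ (αq ∷ʳ d) fd (trans (sym (reassoc-mid a₁ d m fd b₁)) (trans (sym e1) (trans q-st (snoc-snoc αq d fd))))
  ... | inj₂ (b₁' , _ , P) = flip≢d d (all-mid (a₁ ++ d ∷ m) fd b₁' (subst (All (_≡ d)) (sym P) (AllP.∷ʳ⁺ αq-all refl)))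
  ... | inj₁ (_ , P , _) = d≢flip d (∷-injectiveˡ (proj₂ al))
    where
    wv : walk (start p) (a₂ ++ fd ∷ m) ≡ v
    wv = trans (walk-mid (start p) a₂ fd m) (trans (cong (λ z → walk z m) (sym w)) (trans (sym (walk-mid (start q) a₁ d m)) (trans (cong (walk (start q)) P) q-w)))
    al : (a₂ ++ fd ∷ m ≡ α ∷ʳ d) × (_≡_ {A = List Dir} (d ∷ b₂) (fd ∷ []))
    al = align (start p) (steps p) (a₂ ++ fd ∷ m) (d ∷ b₂) (α ∷ʳ d) (fd ∷ [])
           (trans e2 (reassoc-mid a₂ fd m d b₂)) (trans ep (sym (∷ʳ-++ α d _))) (trans wv (sym wp))

  kiss-q⇒straightened : ∀ y → Ext y → Kissing q y → ∃[ p ] ((p , y) ∈ ps)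
  kiss-q⇒straightened y ey k with kiss-elim-swap d q y k
  ... | inj₂ (a₁ , b₁ , a₂ , b₂ , m , e1 , e2 , w) = ⊥-elim (ne-mid m d b₂ (only-last d αq a₂ _ αq-all (trans (sym q-st) e2)))
  ... | inj₁ (a₁ , b₁ , a₂ , b₂ , m , e1 , e2 , w)
      with snoc-split (a₁ ++ d ∷ m) fd b₁ (αq ∷ʳ d) fd (trans (sym (reassoc-mid a₁ d m fd b₁)) (trans (sym e1) (trans q-st (snoc-snoc αq d fd))))
  ... | inj₂ (b₁' , _ , P) = ⊥-elim (flip≢d d (all-mid (a₁ ++ d ∷ m) fd b₁' (subst (All (_≡ d)) (sym P) (AllP.∷ʳ⁺ αq-all refl))))
  ... | inj₁ (_ , P , _) with snocView m
  ... | inj₁ refl = ⊥-elim (proj₂ ey (turns-intro v y a₂ fd b₂ (trans e2 (cong (λ z → a₂ ++ fd ∷ z ∷ b₂) (sym (flip-flip d)))) (trans (sym w) (trans P' q-w))))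
    where
    P' : walk (start q) (a₁ ∷ʳ d) ≡ walk (start q) (αq ∷ʳ d)
    P' = cong (walk (start q)) P
  ... | inj₂ (m' , z , refl) with ∷ʳ-injective (a₁ ++ d ∷ m') αq (trans (++-assoc a₁ (d ∷ m') (z ∷ [])) P)
  ... | P2 , refl = ConstrPy
    where
    wy : walk (start y) ((a₂ ++ fd ∷ m') ∷ʳ d) ≡ v
    wy = trans (cong (walk (start y)) (++-assoc a₂ (fd ∷ m') (d ∷ [])))
          (trans (walk-mid (start y) a₂ fd (m' ∷ʳ d)) (trans (cong (λ z → walk z (m' ∷ʳ d)) (sym w))
          (trans (sym (walk-mid (start q) a₁ d (m' ∷ʳ d))) (trans (cong (walk (start q)) (trans (sym (++-assoc a₁ (d ∷ m') (d ∷ []))) (cong (_∷ʳ d) P2))) q-w))))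
    ey2 : steps y ≡ ((a₂ ++ fd ∷ m') ∷ʳ d) ++ d ∷ b₂
    ey2 = trans e2 (trans (reassoc-mid a₂ fd (m' ∷ʳ d) d b₂) (cong (_++ d ∷ b₂) (sym (++-assoc a₂ (fd ∷ m') (d ∷ [])))))
    ConstrPy : ∃[ p ] ((p , y) ∈ ps)
    ConstrPy with v-is-penultimate (proj₁ (proj₁ ey)) ((a₂ ++ fd ∷ m') ∷ʳ d) d b₂ ey2 wy
    ... | refl with listed-from-straightened y ey a₂ m' (trans ey2 (trans (++-assoc (a₂ ++ fd ∷ m') (d ∷ []) (d ∷ [])) (++-assoc a₂ (fd ∷ m') (d ∷ d ∷ [])))) wy
    ... | p' , m2 , _ = p' , m2

  straightened-kiss-q : ∀ p r → (p , r) ∈ ps → Kissing q r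
  straightened-kiss-q p r m with pr-shape p r m
  ... | α , ep , sr , er , wp with lastNon d α
  ... | inj₁ al = ⊥-elim (p≢q p (∈-map⁺ proj₁ m) (constant-run⇒q p α (psup p (∈-map⁺ proj₁ m)) ep al wp))
  ... | inj₂ (α₁ , δ , eqα , aδ) with runs-comparable αq δ αq-all aδ
  ... | inj₁ (ζ , aζ , eqδ) = ⊥-elim (inner-not-start r q (α₁ ++ fd ∷ ζ) (αq ++ d ∷ d ∷ []) (proj₁ (proj₁ (straightened-Ext p r m))) qsup
          (trans er (trans (cong (_++ d ∷ d ∷ []) eqα') (++-assoc (α₁ ++ fd ∷ ζ) αq _))) (ne-mid α₁ fd ζ) (ne-mid αq d _)
          (walk-inj (start q) _ (αq ∷ʳ d) (trans q-w (trans (sym wp) (trans (cong (λ z → walk z (α ∷ʳ d)) (sym sr))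
             (trans (cong (λ z → walk (start r) (z ∷ʳ d)) eqα') (trans (cong (walk (start r)) (++-assoc (α₁ ++ fd ∷ ζ) αq (d ∷ []))) (walk-++ (start r) (α₁ ++ fd ∷ ζ) (αq ∷ʳ d)))))))))
    where
    eqα' : α ≡ (α₁ ++ fd ∷ ζ) ++ αq
    eqα' = trans eqα (trans (cong (λ z → α₁ ++ fd ∷ z) eqδ) (sym (reassoc-++ α₁ fd ζ αq)))
  ... | inj₂ (ε , aε , eqq) = kiss-intro d q r
          (ε , [] , α₁ , [] , δ ∷ʳ d ,
           trans q-st (trans (cong (_++ d ∷ fd ∷ []) eqq) (trans (reassoc-++ ε d δ _) (cong (λ z → ε ++ d ∷ z) (sym (∷ʳ-++ δ d (fd ∷ [])))))) ,
           trans er (trans (cong (_++ d ∷ d ∷ []) eqα) (trans (reassoc-++ α₁ fd δ _) (cong (λ z → α₁ ++ fd ∷ z) (sym (∷ʳ-++ δ d (d ∷ [])))))) ,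
           walk-inj _ _ (δ ∷ʳ d) (trans (sym (walk-mid (start q) ε d (δ ∷ʳ d)))
             (trans (cong (walk (start q)) (trans (sym (reassoc-++ ε d δ (d ∷ []))) (cong (_∷ʳ d) (sym eqq))))
             (trans q-w (trans (sym wp) (trans (cong (λ z → walk z (α ∷ʳ d)) (sym sr))
             (trans (cong (λ z → walk (start r) (z ∷ʳ d)) eqα) (trans (cong (walk (start r)) (reassoc-++ α₁ fd δ (d ∷ []))) (walk-mid (start r) α₁ fd (δ ∷ʳ d))))))))))

  -- p' is before p: they share the last part of their run into v, p' joining
  -- it from the flip d side and p from the d side.  This is the order of the
  -- listing.
  Before : Path → Path → Set
  Before p' p = ∃[ a₁ ] ∃[ a₂ ] ∃[ m ]
    ( steps p' ≡ a₁ ++ fd ∷ (m ++ d ∷ fd ∷ [])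
    × steps p ≡ a₂ ++ d ∷ (m ++ d ∷ fd ∷ [])
    × walk (start p') (a₁ ∷ʳ fd) ≡ walk (start p) (a₂ ∷ʳ d) )

  turnTail : List Dir
  turnTail = d ∷ fd ∷ []

  Before-irrefl : ∀ p → ¬ Before p p
  Before-irrefl p (a₁ , a₂ , m , e1 , e2 , _) =
    d≢flip d (sym (proj₂ (same-suffix a₁ fd a₂ d m (++-cancelʳ turnTail _ _ (trans (reassoc-++ a₁ fd m turnTail) (trans (sym e1) (trans e2 (sym (reassoc-++ a₂ d m turnTail)))))))))

  Before-asym : ∀ p p' → Before p' p → Before p p' → ⊥
  Before-asym p p' (a₁ , a₂ , m , e1 , e2 , _) (b₁ , b₂ , n , f1 , f2 , _)
    with cmp-split a₂ d m b₁ fd n (++-cancelʳ turnTail _ _ (trans (reassoc-++ a₂ d m turnTail) (trans (sym e2) (trans f1 (sym (reassoc-++ b₁ fd n turnTail))))))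
  ... | inj₁ (_ , e , _) = d≢flip d e
  ... | inj₂ (inj₁ (n₁ , _ , refl)) = flip≢d d (proj₂ (same-suffix a₁ fd (b₂ ++ d ∷ n₁) d m
          (++-cancelʳ turnTail _ _ (trans (reassoc-++ a₁ fd m turnTail) (trans (sym e1) (trans f2 (trans (sym (reassoc-++ b₂ d (n₁ ++ d ∷ m) turnTail)) (cong (_++ turnTail) (sym (reassoc-++ b₂ d n₁ (d ∷ m)))))))))))
  ... | inj₂ (inj₂ (m₁ , _ , refl)) = flip≢d d (proj₂ (same-suffix (a₁ ++ fd ∷ m₁) fd b₂ d n
          (++-cancelʳ turnTail _ _ (trans (cong (_++ turnTail) (reassoc-++ a₁ fd m₁ (fd ∷ n))) (trans (reassoc-++ a₁ fd (m₁ ++ fd ∷ n) turnTail) (trans (sym e1) (trans f2 (sym (reassoc-++ b₂ d n turnTail)))))))))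

  turns-entering-flip : ∀ y (P : List Dir) b → steps y ≡ P ++ fd ∷ d ∷ b → walk (start y) (P ∷ʳ fd) ≡ v → TurnsAt v y
  turns-entering-flip y P b e w = turns-intro v y P fd b (trans e (cong (λ z → P ++ fd ∷ z ∷ b) (sym (flip-flip d)))) w

  kiss-listed⇒ : ∀ p r → (p , r) ∈ ps → ∀ y → Ext y → Kissing p y →
        Kissing r y ⊎ ∃[ p' ] ((p' , y) ∈ ps × Before p' p)
  kiss-listed⇒ p r m y ey k with pr-shape p r m
  ... | α , ep , sr , er , wp with kiss-elim-swap d p y k
  -- p enters the common part by d: the kiss ends before v, and r kisses y
  -- as well, or it ends at v, and y is an earlier straightening.
  ... | inj₁ (a₁ , b₁ , a₂ , b₂ , mm , e1 , e2 , w)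
      with snoc-split (a₁ ++ d ∷ mm) fd b₁ (α ∷ʳ d) fd (trans (sym (reassoc-mid a₁ d mm fd b₁)) (trans (sym e1) (trans ep (snoc-snoc α d fd))))
  ... | inj₂ (b₁' , eb , P) with snocView b₁'
  ... | inj₁ refl = ⊥-elim (flip≢d d (∷ʳ-injectiveʳ (a₁ ++ d ∷ mm) α P))
  ... | inj₂ (b'' , z , refl) with ∷ʳ-injective ((a₁ ++ d ∷ mm) ++ fd ∷ b'') α (trans (reassoc-++ (a₁ ++ d ∷ mm) fd b'' (z ∷ [])) P)
  ... | P2 , refl = inj₁ (kiss-intro d r y (a₁ , b'' ++ d ∷ d ∷ [] , a₂ , b₂ , mm ,
          trans er (trans (cong (_++ d ∷ d ∷ []) (sym P2)) (trans (reassoc-++ (a₁ ++ d ∷ mm) fd b'' _) (sym (reassoc-mid a₁ d mm fd _)))) ,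
          e2 , trans (cong (λ s → walk s (a₁ ∷ʳ d)) sr) w))
  kiss-listed⇒ p r m y ey k | α , ep , sr , er , wp | inj₁ (a₁ , b₁ , a₂ , b₂ , mm , e1 , e2 , w) | inj₁ (_ , P , _) with snocView mm
  ... | inj₁ refl = ⊥-elim (proj₂ ey (turns-entering-flip y a₂ b₂ e2 (trans (sym w) (trans (cong (walk (start p)) P) wp))))
  ... | inj₂ (m' , z , refl) with ∷ʳ-injective (a₁ ++ d ∷ m') α (trans (++-assoc a₁ (d ∷ m') (z ∷ [])) P)
  ... | P2 , refl = inj₂ res
    where
    wy : walk (start y) ((a₂ ++ fd ∷ m') ∷ʳ d) ≡ v
    wy = trans (cong (walk (start y)) (++-assoc a₂ (fd ∷ m') (d ∷ [])))
          (trans (walk-mid (start y) a₂ fd (m' ∷ʳ d)) (trans (cong (λ z → walk z (m' ∷ʳ d)) (sym w))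
          (trans (sym (walk-mid (start p) a₁ d (m' ∷ʳ d))) (trans (cong (walk (start p)) (trans (sym (++-assoc a₁ (d ∷ m') (d ∷ []))) (cong (_∷ʳ d) P2))) wp))))
    ey2 : steps y ≡ ((a₂ ++ fd ∷ m') ∷ʳ d) ++ d ∷ b₂
    ey2 = trans e2 (trans (reassoc-mid a₂ fd (m' ∷ʳ d) d b₂) (cong (_++ d ∷ b₂) (sym (++-assoc a₂ (fd ∷ m') (d ∷ [])))))
    res : ∃[ p' ] ((p' , y) ∈ ps × Before p' p)
    res with v-is-penultimate (proj₁ (proj₁ ey)) ((a₂ ++ fd ∷ m') ∷ʳ d) d b₂ ey2 wy
    ... | refl with listed-from-straightened y ey a₂ m' (trans ey2 (trans (++-assoc (a₂ ++ fd ∷ m') (d ∷ []) (d ∷ [])) (++-assoc a₂ (fd ∷ m') (d ∷ d ∷ [])))) wy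
    ... | p' , m2 , sp' , ep' = p' , m2 , (a₂ , a₁ , m' , ep' ,
            trans ep (trans (cong (_++ turnTail) (sym P2)) (reassoc-++ a₁ d m' turnTail)) ,
            trans (cong (λ s → walk s (a₂ ∷ʳ fd)) sp') (sym w))
  -- p enters the common part by flip d: the kiss ends before p's last step,
  -- so r kisses y as well.
  kiss-listed⇒ p r m y ey k | α , ep , sr , er , wp | inj₂ (a₁ , b₁ , a₂ , b₂ , mm , e1 , e2 , w)
      with snoc-split (a₂ ++ fd ∷ mm) d b₂ (α ∷ʳ d) fd (trans (sym (reassoc-mid a₂ fd mm d b₂)) (trans (sym e2) (trans ep (snoc-snoc α d fd))))
  ... | inj₁ (_ , _ , e) = ⊥-elim (d≢flip d e)
  ... | inj₂ (b₂' , _ , P) = inj₁ (kiss-intro-swap d r y (a₁ , b₁ , a₂ , b₂' ∷ʳ d , mm , e1 ,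
          trans er (trans (snoc-snoc α d d) (trans (cong (_∷ʳ d) (sym P)) (reassoc-snoc a₂ fd mm d b₂' d))) ,
          trans w (cong (λ s → walk s (a₂ ∷ʳ fd)) (sym sr))))

  kiss-straightened⇒kiss-listed : ∀ p r → (p , r) ∈ ps → ∀ y → Ext y → Kissing r y → Kissing p y
  kiss-straightened⇒kiss-listed p r m y ey k with pr-shape p r m
  ... | α , ep , sr , er , wp with kiss-elim-swap d r y k
  ... | inj₁ (a₁ , b₁ , a₂ , b₂ , mm , e1 , e2 , w)
      with snoc-split (a₁ ++ d ∷ mm) fd b₁ (α ∷ʳ d) d (trans (sym (reassoc-mid a₁ d mm fd b₁)) (trans (sym e1) (trans er (snoc-snoc α d d))))
  ... | inj₁ (_ , _ , e) = ⊥-elim (flip≢d d e)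
  ... | inj₂ (b₁' , _ , P) with snocView b₁'
  ... | inj₁ refl = ⊥-elim (flip≢d d (∷ʳ-injectiveʳ (a₁ ++ d ∷ mm) α P))
  ... | inj₂ (b'' , z , refl) with ∷ʳ-injective ((a₁ ++ d ∷ mm) ++ fd ∷ b'') α (trans (reassoc-++ (a₁ ++ d ∷ mm) fd b'' (z ∷ [])) P)
  ... | P2 , refl = kiss-intro d p y (a₁ , b'' ++ d ∷ fd ∷ [] , a₂ , b₂ , mm ,
          trans ep (trans (cong (_++ turnTail) (sym P2)) (trans (reassoc-++ (a₁ ++ d ∷ mm) fd b'' _) (sym (reassoc-mid a₁ d mm fd _)))) ,
          e2 , trans (cong (λ s → walk s (a₁ ∷ʳ d)) (sym sr)) w)
  kiss-straightened⇒kiss-listed p r m y ey k | α , ep , sr , er , wp | inj₂ (a₁ , b₁ , a₂ , b₂ , mm , e1 , e2 , w)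
      with snoc-split (a₂ ++ fd ∷ mm) d b₂ (α ∷ʳ d) d (trans (sym (reassoc-mid a₂ fd mm d b₂)) (trans (sym e2) (trans er (snoc-snoc α d d))))
  ... | inj₂ (b₂' , _ , P) = kiss-intro-swap d p y (a₁ , b₁ , a₂ , b₂' ∷ʳ fd , mm , e1 ,
          trans ep (trans (snoc-snoc α d fd) (trans (cong (_∷ʳ fd) (sym P)) (reassoc-snoc a₂ fd mm d b₂' fd))) ,
          trans w (cong (λ s → walk s (a₂ ∷ʳ fd)) sr))
  ... | inj₁ (_ , P , _) with snocView mm
  ... | inj₁ refl = ⊥-elim (flip≢d d (∷ʳ-injectiveʳ a₂ α P))
  ... | inj₂ (m' , z , refl) with ∷ʳ-injective (a₂ ++ fd ∷ m') α (trans (++-assoc a₂ (fd ∷ m') (z ∷ [])) P)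
  ... | P2 , refl = ⊥-elim (proj₂ ey (turns-intro v y (a₁ ++ d ∷ m') d b₁
          (trans e1 (trans (cong (λ z → a₁ ++ d ∷ z) (++-assoc m' (d ∷ []) (fd ∷ b₁))) (sym (reassoc-++ a₁ d m' _)))) wy))
    where
    wy : walk (start y) ((a₁ ++ d ∷ m') ∷ʳ d) ≡ v
    wy = trans (cong (walk (start y)) (++-assoc a₁ (d ∷ m') (d ∷ [])))
          (trans (walk-mid (start y) a₁ d (m' ∷ʳ d)) (trans (cong (λ z → walk z (m' ∷ʳ d)) w)
          (trans (sym (walk-mid (start r) a₂ fd (m' ∷ʳ d))) (trans (cong (walk (start r)) (trans (sym (++-assoc a₂ (fd ∷ m') (d ∷ []))) (cong (_∷ʳ d) P2)))
            (trans (cong (λ s → walk s (α ∷ʳ d)) sr) wp)))))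

  Before-kiss : ∀ p p' r' → (p' , r') ∈ ps → Before p' p → Kissing p r'
  Before-kiss p p' r' m (a₁ , a₂ , mm , e1 , e2 , w) with pr-shape p' r' m
  ... | α' , ep' , sr' , er' , wp' = kiss-intro d p r' (a₂ , [] , a₁ , [] , mm ∷ʳ d ,
        trans e2 (cong (λ z → a₂ ++ d ∷ z) (sym (∷ʳ-++ mm d (fd ∷ [])))) ,
        trans er' (trans (cong (_++ d ∷ d ∷ []) α'eq) (trans (reassoc-++ a₁ fd mm _) (cong (λ z → a₁ ++ fd ∷ z) (sym (∷ʳ-++ mm d (d ∷ [])))))) ,
        trans (sym w) (cong (λ s → walk s (a₁ ∷ʳ fd)) (sym sr')))
    where
    α'eq : α' ≡ a₁ ++ fd ∷ mm
    α'eq = ++-cancelʳ turnTail _ _ (trans (sym ep') (trans e1 (sym (reassoc-++ a₁ fd mm turnTail))))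

  straightening-injective : ∀ p r p' r' → (p , r) ∈ ps → (p' , r') ∈ ps → r ≡ r' → p ≡ p'
  straightening-injective p r p' r' m m' refl with pr-shape p r m | pr-shape p' r m'
  ... | α , ep , sr , er , _ | α' , ep' , sr' , er' , _ =
    path≡ (trans (sym sr) sr') (trans ep (trans (cong (_++ turnTail) (++-cancelʳ (d ∷ d ∷ []) _ _ (trans (sym er) er'))) (sym ep')))

  listed-nokiss-own : ∀ p r → (p , r) ∈ ps → ¬ Kissing p r
  listed-nokiss-own p r m k with kiss-listed⇒ p r m r (straightened-Ext p r m) k
  ... | inj₁ k' = Kissing-irrefl r k'
  ... | inj₂ (p' , m' , b) with straightening-injective p' r p r m' m refl
  ... | refl = Before-irrefl p' b

  -- Two listed paths kiss iff their straightenings kiss, as both pairs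
  -- end with the same steps d at v.
  kiss-listed⇔kiss-straightened : ∀ p r p' r' → (p , r) ∈ ps → (p' , r') ∈ ps → (Kissing p p' → Kissing r r') × (Kissing r r' → Kissing p p')
  kiss-listed⇔kiss-straightened p r p' r' m m' with pr-shape p r m | pr-shape p' r' m'
  ... | α , ep , sr , er , wp | α' , ep' , sr' , er' , wp' = to , from
    where
    wv : walk (start p) (α ∷ʳ d) ≡ walk (start p') (α' ∷ʳ d)
    wv = trans wp (sym wp')
    wv' : walk (start r) (α ∷ʳ d) ≡ walk (start r') (α' ∷ʳ d)
    wv' = trans (cong (λ s → walk s (α ∷ʳ d)) sr) (trans wv (cong (λ s → walk s (α' ∷ʳ d)) (sym sr')))
    to : Kissing p p' → Kissing r r'
    to k with kiss-elim-swap d p p' k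
    ... | inj₁ kk = kiss-intro d r r' (Kd-change-last d d fd d p p' r r' α α' sr sr' ep ep' er er' wv kk)
    ... | inj₂ kk = kiss-intro-swap d r r' (Kd-change-last d d fd d p' p r' r α' α sr' sr ep' ep er' er (sym wv) kk)
    from : Kissing r r' → Kissing p p'
    from k with kiss-elim-swap d r r' k
    ... | inj₁ kk = kiss-intro d p p' (Kd-change-last d d d fd r r' p p' α α' (sym sr) (sym sr') er er' ep ep' wv' kk)
    ... | inj₂ kk = kiss-intro-swap d p p' (Kd-change-last d d d fd r' r p' p α' α (sym sr') (sym sr) er' er ep' ep (sym wv') kk)

  kiss-earlier⇔ : ∀ p r p' r' → (p , r) ∈ ps → (p' , r') ∈ ps → Before p' p → (Kissing p p' → Kissing p' r) × (Kissing p' r → Kissing p p')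
  kiss-earlier⇔ p r p' r' m m' b = to , from
    where
    to : Kissing p p' → Kissing p' r
    to k = kiss-straightened⇒kiss-listed p' r' m' r (straightened-Ext p r m) (Kissing-sym r r' (proj₁ (kiss-listed⇔kiss-straightened p r p' r' m m') k))
    from : Kissing p' r → Kissing p p'
    from k with kiss-listed⇒ p' r' m' r (straightened-Ext p r m) k
    ... | inj₁ k' = proj₂ (kiss-listed⇔kiss-straightened p r p' r' m m') (Kissing-sym r' r k')
    ... | inj₂ (p'' , m'' , b') with straightening-injective p'' r p r m'' m refl
    ... | refl = ⊥-elim (Before-asym p p' b b')

  EntersS : Path → Path → Set
  EntersS p₁ p₂ = ∃[ a₁ ] ∃[ a₂ ] ∃[ m ]
    ( steps p₁ ≡ a₁ ++ S ∷ (m ++ d ∷ fd ∷ [])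
    × steps p₂ ≡ a₂ ++ E ∷ (m ++ d ∷ fd ∷ [])
    × walk (start p₁) (a₁ ∷ʳ S) ≡ walk (start p₂) (a₂ ∷ʳ E) )

  common-run-to-end : ∀ p₁ p₂ → p₁ ∈ map proj₁ ps → p₂ ∈ map proj₁ ps → ∀ a₁ mm b₁ a₂ b₂
    → steps p₁ ≡ a₁ ++ mm ++ b₁ → steps p₂ ≡ a₂ ++ mm ++ b₂ → walk (start p₁) a₁ ≡ walk (start p₂) a₂
    → EdgeIn (walk (start p₁) a₁) mm (edgeInto d v)
    → ¬ (∃[ d' ] ∃[ b₁' ] ∃[ b₂' ] (b₁ ≡ d' ∷ b₁' × b₂ ≡ d' ∷ b₂'))
    → ∃[ α ] (mm ≡ α ++ d ∷ fd ∷ [] × b₁ ≡ [] × b₂ ≡ [])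
  common-run-to-end p₁ p₂ m₁ m₂ a₁ mm b₁ a₂ b₂ e1 e2 w (α , dd , β , em , wα , mv) nfwd
    with step-into-v-dir d dd (trans mv (edgeInto-target d v)) | p-shape p₁ m₁ | p-shape p₂ m₂
  ... | refl | γ₁ , f1 , g1 | γ₂ , f2 , g2 = tail β refl (proj₂ al1) (proj₂ al2)
    where
    wv1 : walk (start p₁) ((a₁ ++ α) ∷ʳ d) ≡ v
    wv1 = trans (cong (walk (start p₁)) (++-assoc a₁ α (d ∷ []))) (trans (walk-++ (start p₁) a₁ (α ∷ʳ d))
            (trans (walk-∷ʳ _ α d) (trans (cong (λ z → move z d) wα) (edgeInto-step d))))
    wv2 : walk (start p₂) ((a₂ ++ α) ∷ʳ d) ≡ v
    wv2 = trans (cong (walk (start p₂)) (++-assoc a₂ α (d ∷ []))) (trans (walk-++ (start p₂) a₂ (α ∷ʳ d))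
            (trans (cong (λ s → walk s (α ∷ʳ d)) (sym w)) (trans (walk-∷ʳ _ α d) (trans (cong (λ z → move z d) wα) (edgeInto-step d)))))
    sp : ∀ (a : List Dir) (b : List Dir) → a ++ (α ++ d ∷ β) ++ b ≡ ((a ++ α) ∷ʳ d) ++ (β ++ b)
    sp a b = trans (cong (a ++_) (trans (++-assoc α (d ∷ β) b) (sym (∷ʳ-++ α d (β ++ b)))))
               (trans (sym (++-assoc a (α ∷ʳ d) (β ++ b))) (cong (_++ (β ++ b)) (sym (++-assoc a α (d ∷ [])))))
    -- after the edge into v both paths only make their final step fd
    al1 : ((a₁ ++ α) ∷ʳ d ≡ γ₁ ∷ʳ d) × (β ++ b₁ ≡ fd ∷ [])
    al1 = align (start p₁) (steps p₁) ((a₁ ++ α) ∷ʳ d) (β ++ b₁) (γ₁ ∷ʳ d) (fd ∷ [])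
            (trans e1 (trans (cong (λ z → a₁ ++ z ++ b₁) em) (sp a₁ b₁))) (trans f1 (sym (∷ʳ-++ γ₁ d _))) (trans wv1 (sym g1))
    al2 : ((a₂ ++ α) ∷ʳ d ≡ γ₂ ∷ʳ d) × (β ++ b₂ ≡ fd ∷ [])
    al2 = align (start p₂) (steps p₂) ((a₂ ++ α) ∷ʳ d) (β ++ b₂) (γ₂ ∷ʳ d) (fd ∷ [])
            (trans e2 (trans (cong (λ z → a₂ ++ z ++ b₂) em) (sp a₂ b₂))) (trans f2 (sym (∷ʳ-++ γ₂ d _))) (trans wv2 (sym g2))
    tail : ∀ β' → β ≡ β' → β' ++ b₁ ≡ fd ∷ [] → β' ++ b₂ ≡ fd ∷ [] → ∃[ α ] (mm ≡ α ++ d ∷ fd ∷ [] × b₁ ≡ [] × b₂ ≡ [])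
    tail [] eβ eb1 eb2 = ⊥-elim (nfwd (fd , [] , [] , eb1 , eb2))
    tail (x ∷ []) eβ eb1 eb2 = α , trans em (cong (λ z → α ++ d ∷ z) (trans eβ (cong (_∷ []) (∷-injectiveˡ eb1)))) ,
                                 ∷-injectiveʳ eb1 , ∷-injectiveʳ eb2
    tail (x ∷ y ∷ _) eβ eb1 eb2 = ⊥-elim (cons≢ (∷-injectiveʳ eb1))

  -- A common final run of two listed paths which cannot be extended
  -- backwards, entered by p₁ from the North, is entered by p₂ from the West:
  -- p₂ cannot start inside p₁.
  common-run-entered : ∀ p₁ p₂ → p₁ ∈ map proj₁ ps → p₂ ∈ map proj₁ ps → ∀ a₁' a₂ α
    → steps p₁ ≡ (a₁' ∷ʳ S) ++ α ++ d ∷ fd ∷ [] → steps p₂ ≡ a₂ ++ α ++ d ∷ fd ∷ []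
    → walk (start p₁) (a₁' ∷ʳ S) ≡ walk (start p₂) a₂
    → ¬ (∃[ a₁'' ] ∃[ a₂' ] ∃[ d' ] (a₁' ∷ʳ S ≡ a₁'' ∷ʳ d' × a₂ ≡ a₂' ∷ʳ d'))
    → EntersS p₁ p₂
  common-run-entered p₁ p₂ m₁ m₂ a₁' a₂ α st1 st2 w nback with snocView a₂
  ... | inj₁ refl = ⊥-elim (inner-not-start p₁ p₂ (a₁' ∷ʳ S) (α ++ d ∷ fd ∷ []) (psup p₁ m₁) (psup p₂ m₂) st1
                      (ne-snoc a₁' S) (ne-mid α d _) (sym w))
  ... | inj₂ (a₂' , S , refl) = ⊥-elim (nback (a₁' , a₂' , S , refl , refl))
  ... | inj₂ (a₂' , E , refl) = a₁' , a₂' , α ,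
        trans st1 (++-assoc a₁' (S ∷ []) _) , trans st2 (++-assoc a₂' (E ∷ []) _) , w

  -- The orders ≺_e of the statement, on listed paths, say which path enters
  -- the common final run from the North.
  Prec⇒EntersS : ∀ p₁ p₂ → p₁ ∈ map proj₁ ps → p₂ ∈ map proj₁ ps → Prec (edgeInto d v) p₁ p₂ → EntersS p₁ p₂
  Prec⇒EntersS p₁ p₂ m₁ m₂ (a₁ , mm , b₁ , a₂ , b₂ , e1 , e2 , w , eIn , nback , nfwd , last)
    with common-run-to-end p₁ p₂ m₁ m₂ a₁ mm b₁ a₂ b₂ e1 e2 w eIn nfwd
  ... | α , refl , refl , refl with last
  ... | inj₂ (_ , ())
  ... | inj₁ (a₁' , refl) = common-run-entered p₁ p₂ m₁ m₂ a₁' a₂ α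
        (trans e1 (cong ((a₁' ∷ʳ S) ++_) (++-identityʳ _))) (trans e2 (cong (a₂ ++_) (++-identityʳ _))) w nback

PairWith : Path → List Path → Path → Path → Set
PairWith q L x y = (x ≡ q × y ∈ L) ⊎ (y ≡ q × x ∈ L)

PairWith-sym : ∀ q L x y → PairWith q L x y → PairWith q L y x
PairWith-sym q L x y (inj₁ (a , b)) = inj₂ (a , b)
PairWith-sym q L x y (inj₂ (a , b)) = inj₁ (a , b)

-- The
-- other listing (that of the opposite path qF) enters as `doneF`, the listed
-- paths already added, and `restF`, the straightenings whose exceptional
-- pairs with qF are still present; one of them is empty.
module Phase (Λ : Shape) (c : Point) (sec : SECorner Λ c) (vint : Interior Λ (northWest c))
          (d : Dir) (q : Path) (qok : IsOnlyTurnPath Λ (northWest c) d q)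
          (ps : List (Path × Path))
          (mem : ∀ p → p ∈ map proj₁ ps ⇔ (Supported Λ p × p ≢ q × TurnsAt (northWest c) p × HasEdge p (edgeInto d (northWest c))))
          (strs : All (λ pr → Straightened (northWest c) (proj₁ pr) (proj₂ pr)) ps)
          (uniq : Unique (map proj₁ ps))
          (ord : AllPairs (λ x y → Side.Before Λ c sec vint d q qok ps mem strs (proj₁ x) (proj₁ y)) ps)
          (qF : Path) (tF : TurnsAtEntering (flip d) (northWest c) qF)
          (doneF restF : List (Path × Path))
          (dF : ∀ x → x ∈ map proj₁ doneF → TurnsAtEntering (flip d) (northWest c) x)
          (rF : ∀ y → y ∈ map proj₂ restF → ¬ TurnsAt (northWest c) y) where
  open Corner Λ c sec vint
  open Side Λ c sec vint d q qok ps mem strs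

  -- The state after adding the listed paths in `done`: the vertices are the
  -- NK-vertices not turning at v, q, qF, and the listed paths added so far ...
  V : List (Path × Path) → Path → Set
  V done x = NKVertex Λ x × (¬ TurnsAt v x ⊎ x ≡ q ⊎ x ≡ qF ⊎ x ∈ map proj₁ done ⊎ x ∈ map proj₁ doneF)

  -- ... compatible when non-kissing or forming an exceptional pair (q, r_j),
  -- r_j from the straightenings still to be processed, or (qF, r) with r in
  -- restF.
  R : List (Path × Path) → Path → Path → Set
  R rest x y = ¬ Kissing x y ⊎ PairWith q (map proj₂ rest) x y ⊎ PairWith qF (map proj₂ restF) x y

  R-sym : ∀ rest x y → R rest x y → R rest y x
  R-sym rest x y (inj₁ nk) = inj₁ (λ k → nk (Kissing-sym y x k))
  R-sym rest x y (inj₂ (inj₁ s)) = inj₂ (inj₁ (PairWith-sym _ _ x y s))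
  R-sym rest x y (inj₂ (inj₂ s)) = inj₂ (inj₂ (PairWith-sym _ _ x y s))

  q-entering : TurnsAtEntering d v q
  q-entering = proj₁ (proj₂ qok)

  listed-entering : ∀ p → p ∈ map proj₁ ps → TurnsAtEntering d v p
  listed-entering p m with p-shape p m
  ... | α , e1 , e2 = entering-intro d v p α [] e1 e2

  opposite-entering-≢ : ∀ x y → TurnsAtEntering d v x → TurnsAtEntering (flip d) v y → x ≢ y
  opposite-entering-≢ x y tx ty refl = turns-one-side d v x tx ty

  straightening-Ext : ∀ y → y ∈ map proj₂ ps → Ext y
  straightening-Ext y m with ∈-map⁻ proj₂ m
  ... | (p , r) , m' , refl = straightened-Ext p r m'

  straightening-not-turning : ∀ y → y ∈ map proj₂ ps → ¬ TurnsAt v y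
  straightening-not-turning y m = proj₂ (straightening-Ext y m)

  turn∉ : ∀ dd x L → TurnsAtEntering dd v x → (∀ y → y ∈ L → ¬ TurnsAt v y) → x ∉ L
  turn∉ dd x L t h m = h x m (entering⇒turns dd v x t)

  q-kiss-qF : Kissing q qF
  q-kiss-qF = kiss-intro d q qF (opposite-turns-kiss d v q qF q-entering tF)

  module Step (done : List (Path × Path)) (p r : Path) (rest : List (Path × Path)) (eps : ps ≡ done ++ (p , r) ∷ rest) where

    L0 L1 : List Path
    L0 = map proj₂ ((p , r) ∷ rest)
    L1 = map proj₂ rest

    pr∈ : (p , r) ∈ ps
    pr∈ = subst ((p , r) ∈_) (sym eps) (∈-++⁺ʳ done (here refl))

    sub∈ : ∀ {x} → x ∈ (p , r) ∷ rest → x ∈ ps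
    sub∈ m = subst (_ ∈_) (sym eps) (∈-++⁺ʳ done m)

    done∈ : ∀ {x} → x ∈ done → x ∈ ps
    done∈ m = subst (_ ∈_) (sym eps) (∈-++⁺ˡ m)

    L0⊆ : ∀ {y} → y ∈ L0 → y ∈ map proj₂ ps
    L0⊆ m with ∈-map⁻ proj₂ m
    ... | x , xm , refl = ∈-map⁺ proj₂ (sub∈ xm)

    spl : All (λ x → Before (proj₁ x) p) done × All (λ y → Before p (proj₁ y)) rest
    spl = allpairs-split done (p , r) rest (subst (AllPairs _) eps ord)

    bef-done : ∀ {x} → x ∈ done → Before (proj₁ x) p
    bef-done m = lookup (proj₁ spl) m

    bef-rest : ∀ {x} → x ∈ rest → Before p (proj₁ x)
    bef-rest m = lookup (proj₂ spl) m

    uspl : All (_≢ p) (map proj₁ done) × All (p ≢_) (map proj₁ rest)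
    uspl = allpairs-split (map proj₁ done) p (map proj₁ rest) (subst Unique (trans (cong (map proj₁) eps) (map-++ proj₁ done _)) uniq)

    p∉done : p ∉ map proj₁ done
    p∉done m = lookup (proj₁ uspl) m refl

    p∉rest : p ∉ map proj₁ rest
    p∉rest m = lookup (proj₂ uspl) m refl

    pm : p ∈ map proj₁ ps
    pm = ∈-map⁺ proj₁ pr∈

    p-entering : TurnsAtEntering d v p
    p-entering = listed-entering p pm

    r-Ext : Ext r
    r-Ext = straightened-Ext p r pr∈

    p≢q-here : p ≢ q
    p≢q-here = p≢q p pm

    q≢r : q ≢ r
    q≢r e = proj₂ r-Ext (subst (TurnsAt v) e (entering⇒turns d v q q-entering))

    p≢qF : p ≢ qF
    p≢qF = opposite-entering-≢ p qF p-entering tF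

    q≢qF : q ≢ qF
    q≢qF = opposite-entering-≢ q qF q-entering tF

    ¬V : ¬ V done p
    ¬V (_ , inj₁ nt) = nt (entering⇒turns d v p p-entering)
    ¬V (_ , inj₂ (inj₁ e)) = p≢q-here e
    ¬V (_ , inj₂ (inj₂ (inj₁ e))) = p≢qF e
    ¬V (_ , inj₂ (inj₂ (inj₂ (inj₁ m)))) = p∉done m
    ¬V (_ , inj₂ (inj₂ (inj₂ (inj₂ m)))) = opposite-entering-≢ p p p-entering (dF p m) refl

    Vr : V done r
    Vr = proj₁ r-Ext , inj₁ (proj₂ r-Ext)

    Vq : V done q
    Vq = q-NK , inj₂ (inj₁ refl)

    Rrq : R ((p , r) ∷ rest) r q
    Rrq = inj₂ (inj₁ (inj₂ (refl , here refl)))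

    Rrefl : ∀ a → V done a → R ((p , r) ∷ rest) a a
    Rrefl a _ = inj₁ (Kissing-irrefl a)

    r∉L1 : r ∉ L1
    r∉L1 m with ∈-map⁻ proj₂ m
    ... | (p'' , r'') , m'' , refl with straightening-injective p'' r'' p r'' (sub∈ (there m'')) pr∈ refl
    ... | refl = p∉rest (∈-map⁺ proj₁ m'')

    R0 R1 : Path → Path → Set
    R0 = R ((p , r) ∷ rest)
    R1 = R rest

    -- The heart of
    -- the step: for every current vertex b, b is in that link iff b is compatible
    -- with p in the next state; this is checked by cases on b.
    InLink : Path → Set
    InLink a = a ≡ r ⊎ a ≡ q ⊎ (R0 a r × R0 a q)

    not-turning-≢ : ∀ dd x y → ¬ TurnsAt v x → TurnsAtEntering dd v y → x ≢ y
    not-turning-≢ dd x y nt t refl = nt (entering⇒turns dd v y t)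

    r-not-turning : ¬ TurnsAt v r
    r-not-turning = proj₂ r-Ext

    R0-ext-r : ∀ b → ¬ TurnsAt v b → R0 b r → ¬ Kissing b r
    R0-ext-r b nt (inj₁ nk) = nk
    R0-ext-r b nt (inj₂ (inj₁ (inj₁ (e , _)))) = ⊥-elim (not-turning-≢ d b q nt q-entering e)
    R0-ext-r b nt (inj₂ (inj₁ (inj₂ (e , _)))) = ⊥-elim (q≢r (sym e))
    R0-ext-r b nt (inj₂ (inj₂ (inj₁ (e , _)))) = ⊥-elim (not-turning-≢ (flip d) b qF nt tF e)
    R0-ext-r b nt (inj₂ (inj₂ (inj₂ (e , _)))) = ⊥-elim (not-turning-≢ (flip d) r qF r-not-turning tF e)

    R0-ext-q : ∀ b → ¬ TurnsAt v b → R0 b q → ¬ Kissing b q ⊎ b ∈ L0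
    R0-ext-q b nt (inj₁ nk) = inj₁ nk
    R0-ext-q b nt (inj₂ (inj₁ (inj₁ (e , _)))) = ⊥-elim (not-turning-≢ d b q nt q-entering e)
    R0-ext-q b nt (inj₂ (inj₁ (inj₂ (_ , m)))) = inj₂ m
    R0-ext-q b nt (inj₂ (inj₂ (inj₁ (e , _)))) = ⊥-elim (not-turning-≢ (flip d) b qF nt tF e)
    R0-ext-q b nt (inj₂ (inj₂ (inj₂ (e , _)))) = ⊥-elim (q≢qF e)

    R1-p : ∀ b → b ≢ q → b ≢ qF → R1 p b → ¬ Kissing p b
    R1-p b bq bqF (inj₁ nk) = nk
    R1-p b bq bqF (inj₂ (inj₁ (inj₁ (e , _)))) = ⊥-elim (p≢q-here e)
    R1-p b bq bqF (inj₂ (inj₁ (inj₂ (e , _)))) = ⊥-elim (bq e)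
    R1-p b bq bqF (inj₂ (inj₂ (inj₁ (e , _)))) = ⊥-elim (p≢qF e)
    R1-p b bq bqF (inj₂ (inj₂ (inj₂ (e , _)))) = ⊥-elim (bqF e)

    -- b does not turn at v: by `kiss-listed⇒`, b kisses r or is an earlier
    -- straightening, which the link excludes.
    notTurning⇒ : ∀ b → Ext b → InLink b → R1 p b
    notTurning⇒ b eb (inj₁ refl) = inj₁ (listed-nokiss-own p r pr∈)
    notTurning⇒ b eb (inj₂ (inj₁ e)) = ⊥-elim (not-turning-≢ d b q (proj₂ eb) q-entering e)
    notTurning⇒ b eb (inj₂ (inj₂ (r0r , r0q))) = inj₁ nk
      where
      nbr : ¬ Kissing b r
      nbr = R0-ext-r b (proj₂ eb) r0r
      nk : ¬ Kissing p b
      nk k with kiss-listed⇒ p r pr∈ b eb k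
      ... | inj₁ krb = nbr (Kissing-sym r b krb)
      ... | inj₂ (p' , m' , bf) with R0-ext-q b (proj₂ eb) r0q
      ... | inj₁ nbq = nbq (Kissing-sym q b (straightened-kiss-q p' b m'))
      ... | inj₂ bL0 with ∈-map⁻ proj₂ bL0
      ... | (p'' , r'') , m'' , refl with straightening-injective p' r'' p'' r'' m' (sub∈ m'') refl
      ... | refl with m''
      ... | here refl = Before-irrefl p bf
      ... | there mr = Before-asym p p' bf (bef-rest mr)

    notTurning⇐ : ∀ b → Ext b → R1 p b → InLink b
    notTurning⇐ b eb r1 with b ≟Path r
    ... | yes e = inj₁ e
    ... | no ne = inj₂ (inj₂ (inj₁ nbr , r0q))
      where
      nk : ¬ Kissing p b
      nk = R1-p b (not-turning-≢ d b q (proj₂ eb) q-entering) (not-turning-≢ (flip d) b qF (proj₂ eb) tF) r1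
      nbr : ¬ Kissing b r
      nbr k = nk (kiss-straightened⇒kiss-listed p r pr∈ b eb (Kissing-sym b r k))
      r0q : R0 b q
      r0q with b ∈? L0
      ... | yes m = inj₂ (inj₁ (inj₂ (refl , m)))
      ... | no nm = inj₁ nbq
        where
        nbq : ¬ Kissing b q
        nbq k with kiss-q⇒straightened b eb (Kissing-sym b q k)
        ... | p' , m' with ∈-++⁻ done (subst ((p' , b) ∈_) eps m')
        ... | inj₁ md = nk (Before-kiss p p' b m' (bef-done md))
        ... | inj₂ mr = nm (∈-map⁺ proj₂ mr)

    -- b = q: p does not kiss q.
    q-case⇒ : InLink q → R1 p q
    q-case⇒ _ = inj₁ (listed-nokiss-q p pm)
    q-case⇐ : R1 p q → InLink q
    q-case⇐ _ = inj₂ (inj₁ refl)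

    -- b = qF, or a listed path of the other side: both conditions fail, as
    -- such paths kiss q and p.
    qF-not-in-link : ¬ InLink qF
    qF-not-in-link (inj₁ e) = not-turning-≢ (flip d) r qF r-not-turning tF (sym e)
    qF-not-in-link (inj₂ (inj₁ e)) = q≢qF (sym e)
    qF-not-in-link (inj₂ (inj₂ (_ , inj₁ nk))) = nk (Kissing-sym q qF q-kiss-qF)
    qF-not-in-link (inj₂ (inj₂ (_ , inj₂ (inj₁ (inj₁ (e , _)))))) = q≢qF (sym e)
    qF-not-in-link (inj₂ (inj₂ (_ , inj₂ (inj₁ (inj₂ (_ , m)))))) = turn∉ (flip d) qF L0 tF (λ y m → straightening-not-turning y (L0⊆ m)) m
    qF-not-in-link (inj₂ (inj₂ (_ , inj₂ (inj₂ (inj₁ (_ , m)))))) = turn∉ d q (map proj₂ restF) q-entering rF m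
    qF-not-in-link (inj₂ (inj₂ (_ , inj₂ (inj₂ (inj₂ (e , _)))))) = q≢qF e
    qF-not-compatible : ¬ R1 p qF
    qF-not-compatible (inj₁ nk) = nk (kiss-intro d p qF (opposite-turns-kiss d v p qF p-entering tF))
    qF-not-compatible (inj₂ (inj₁ (inj₁ (e , _)))) = p≢q-here e
    qF-not-compatible (inj₂ (inj₁ (inj₂ (e , _)))) = q≢qF (sym e)
    qF-not-compatible (inj₂ (inj₂ (inj₁ (e , _)))) = p≢qF e
    qF-not-compatible (inj₂ (inj₂ (inj₂ (_ , m)))) = turn∉ d p (map proj₂ restF) p-entering rF m

    earlier-R0-r : ∀ b → b ∈ map proj₁ ps → R0 b r → ¬ Kissing b r
    earlier-R0-r b bm (inj₁ nk) = nk
    earlier-R0-r b bm (inj₂ (inj₁ (inj₁ (e , _)))) = ⊥-elim (p≢q b bm e)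
    earlier-R0-r b bm (inj₂ (inj₁ (inj₂ (e , _)))) = ⊥-elim (q≢r (sym e))
    earlier-R0-r b bm (inj₂ (inj₂ (inj₁ (e , _)))) = ⊥-elim (opposite-entering-≢ b qF (listed-entering b bm) tF e)
    earlier-R0-r b bm (inj₂ (inj₂ (inj₂ (e , _)))) = ⊥-elim (not-turning-≢ (flip d) r qF r-not-turning tF e)

    earlier⇒ : ∀ b → b ∈ map proj₁ done → InLink b → R1 p b
    earlier⇒ b bd nb with ∈-map⁻ proj₁ bd
    ... | (b' , rb) , md , refl = res nb
      where
      bm : b' ∈ map proj₁ ps
      bm = ∈-map⁺ proj₁ (done∈ md)
      res : InLink b' → R1 p b'
      res (inj₁ e) = ⊥-elim (not-turning-≢ d r b' r-not-turning (listed-entering b' bm) (sym e))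
      res (inj₂ (inj₁ e)) = ⊥-elim (p≢q b' bm e)
      res (inj₂ (inj₂ (r0r , _))) = inj₁ λ k → earlier-R0-r b' bm r0r (proj₁ (kiss-earlier⇔ p r b' rb pr∈ (done∈ md) (bef-done md)) k)

    earlier⇐ : ∀ b → b ∈ map proj₁ done → R1 p b → InLink b
    earlier⇐ b bd r1 with ∈-map⁻ proj₁ bd
    ... | (b' , rb) , md , refl = inj₂ (inj₂ (inj₁ (λ k → nk (proj₂ (kiss-earlier⇔ p r b' rb pr∈ (done∈ md) (bef-done md)) k)) , inj₁ (listed-nokiss-q b' bm)))
      where
      bm : b' ∈ map proj₁ ps
      bm = ∈-map⁺ proj₁ (done∈ md)
      nk : ¬ Kissing p b'
      nk = R1-p b' (p≢q b' bm) (opposite-entering-≢ b' qF (listed-entering b' bm) tF) r1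

    other-side-not-in-link : ∀ b → b ∈ map proj₁ doneF → ¬ InLink b
    other-side-not-in-link b bm (inj₁ e) = not-turning-≢ (flip d) r b r-not-turning (dF b bm) (sym e)
    other-side-not-in-link b bm (inj₂ (inj₁ e)) = opposite-entering-≢ q b q-entering (dF b bm) (sym e)
    other-side-not-in-link b bm (inj₂ (inj₂ (_ , inj₁ nk))) = nk (Kissing-sym q b (kiss-intro d q b (opposite-turns-kiss d v q b q-entering (dF b bm))))
    other-side-not-in-link b bm (inj₂ (inj₂ (_ , inj₂ (inj₁ (inj₁ (e , _)))))) = opposite-entering-≢ q b q-entering (dF b bm) (sym e)
    other-side-not-in-link b bm (inj₂ (inj₂ (_ , inj₂ (inj₁ (inj₂ (_ , m)))))) = turn∉ (flip d) b L0 (dF b bm) (λ y m → straightening-not-turning y (L0⊆ m)) m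
    other-side-not-in-link b bm (inj₂ (inj₂ (_ , inj₂ (inj₂ (inj₁ (_ , m)))))) = turn∉ d q (map proj₂ restF) q-entering rF m
    other-side-not-in-link b bm (inj₂ (inj₂ (_ , inj₂ (inj₂ (inj₂ (e , _)))))) = q≢qF e
    other-side-not-compatible : ∀ b → b ∈ map proj₁ doneF → ¬ R1 p b
    other-side-not-compatible b bm (inj₁ nk) = nk (kiss-intro d p b (opposite-turns-kiss d v p b p-entering (dF b bm)))
    other-side-not-compatible b bm (inj₂ (inj₁ (inj₁ (e , _)))) = p≢q-here e
    other-side-not-compatible b bm (inj₂ (inj₁ (inj₂ (e , _)))) = opposite-entering-≢ q b q-entering (dF b bm) (sym e)
    other-side-not-compatible b bm (inj₂ (inj₂ (inj₁ (e , _)))) = p≢qF e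
    other-side-not-compatible b bm (inj₂ (inj₂ (inj₂ (_ , m)))) = turn∉ d p (map proj₂ restF) p-entering rF m

    link⇒compatible : ∀ b → V done b → InLink b → R1 p b
    link⇒compatible b (nk , inj₁ nt) n = notTurning⇒ b (nk , nt) n
    link⇒compatible b (nk , inj₂ (inj₁ refl)) n = q-case⇒ n
    link⇒compatible b (nk , inj₂ (inj₂ (inj₁ refl))) n = ⊥-elim (qF-not-in-link n)
    link⇒compatible b (nk , inj₂ (inj₂ (inj₂ (inj₁ m)))) n = earlier⇒ b m n
    link⇒compatible b (nk , inj₂ (inj₂ (inj₂ (inj₂ m)))) n = ⊥-elim (other-side-not-in-link b m n)

    compatible⇒link : ∀ b → V done b → R1 p b → InLink b
    compatible⇒link b (nk , inj₁ nt) r1 = notTurning⇐ b (nk , nt) r1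
    compatible⇒link b (nk , inj₂ (inj₁ refl)) r1 = q-case⇐ r1
    compatible⇒link b (nk , inj₂ (inj₂ (inj₁ refl))) r1 = ⊥-elim (qF-not-compatible r1)
    compatible⇒link b (nk , inj₂ (inj₂ (inj₂ (inj₁ m)))) r1 = earlier⇐ b m r1
    compatible⇒link b (nk , inj₂ (inj₂ (inj₂ (inj₂ m)))) r1 = ⊥-elim (other-side-not-compatible b m r1)

    -- Old pairs: compatibility is kept except for the pair {r, q}, whose
    -- exceptional status is used up.
    IsEdgeRQ : Path → Path → Set
    IsEdgeRQ a b = (a ≡ r × b ≡ q) ⊎ (a ≡ q × b ≡ r)

    old-pair⇒ : ∀ a b → R0 a b × ¬ IsEdgeRQ a b → R1 a b
    old-pair⇒ a b (inj₁ nk , _) = inj₁ nk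
    old-pair⇒ a b (inj₂ (inj₂ s) , _) = inj₂ (inj₂ s)
    old-pair⇒ a b (inj₂ (inj₁ (inj₁ (e , here e'))) , np) = ⊥-elim (np (inj₂ (e , e')))
    old-pair⇒ a b (inj₂ (inj₁ (inj₁ (e , there m))) , np) = inj₂ (inj₁ (inj₁ (e , m)))
    old-pair⇒ a b (inj₂ (inj₁ (inj₂ (e , here e'))) , np) = ⊥-elim (np (inj₁ (e' , e)))
    old-pair⇒ a b (inj₂ (inj₁ (inj₂ (e , there m))) , np) = inj₂ (inj₁ (inj₂ (e , m)))

    ¬R1-r-q : ¬ R1 r q
    ¬R1-r-q (inj₁ nk) = nk (Kissing-sym q r (straightened-kiss-q p r pr∈))
    ¬R1-r-q (inj₂ (inj₁ (inj₁ (e , _)))) = q≢r (sym e)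
    ¬R1-r-q (inj₂ (inj₁ (inj₂ (_ , m)))) = r∉L1 m
    ¬R1-r-q (inj₂ (inj₂ (inj₁ (e , _)))) = not-turning-≢ (flip d) r qF r-not-turning tF e
    ¬R1-r-q (inj₂ (inj₂ (inj₂ (e , _)))) = q≢qF e

    old-pair⇐ : ∀ a b → R1 a b → R0 a b × ¬ IsEdgeRQ a b
    old-pair⇐ a b r1 = r0 r1 , np
      where
      r0 : R1 a b → R0 a b
      r0 (inj₁ nk) = inj₁ nk
      r0 (inj₂ (inj₁ (inj₁ (e , m)))) = inj₂ (inj₁ (inj₁ (e , there m)))
      r0 (inj₂ (inj₁ (inj₂ (e , m)))) = inj₂ (inj₁ (inj₂ (e , there m)))
      r0 (inj₂ (inj₂ s)) = inj₂ (inj₂ s)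
      np : ¬ IsEdgeRQ a b
      np (inj₁ (refl , refl)) = ¬R1-r-q r1
      np (inj₂ (refl , refl)) = ¬R1-r-q (R-sym rest q r r1)

    V1 : Path → Set
    V1 = V (done ∷ʳ (p , r))

    mp : map proj₁ (done ∷ʳ (p , r)) ≡ map proj₁ done ∷ʳ p
    mp = map-++ proj₁ done ((p , r) ∷ [])

    V1⇒ : ∀ a → V1 a → V done a ⊎ a ≡ p
    V1⇒ a (nk , inj₂ (inj₂ (inj₂ (inj₁ m)))) with ∈-++⁻ (map proj₁ done) (subst (a ∈_) mp m)
    ... | inj₁ m' = inj₁ (nk , inj₂ (inj₂ (inj₂ (inj₁ m'))))
    ... | inj₂ (here e) = inj₂ e
    ... | inj₂ (there ())
    V1⇒ a (nk , inj₁ x) = inj₁ (nk , inj₁ x)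
    V1⇒ a (nk , inj₂ (inj₁ x)) = inj₁ (nk , inj₂ (inj₁ x))
    V1⇒ a (nk , inj₂ (inj₂ (inj₁ x))) = inj₁ (nk , inj₂ (inj₂ (inj₁ x)))
    V1⇒ a (nk , inj₂ (inj₂ (inj₂ (inj₂ x)))) = inj₁ (nk , inj₂ (inj₂ (inj₂ (inj₂ x))))

    ⇒V1 : ∀ a → V done a ⊎ a ≡ p → V1 a
    ⇒V1 a (inj₂ refl) = listed-NK p pm , inj₂ (inj₂ (inj₂ (inj₁ (subst (p ∈_) (sym mp) (∈-++⁺ʳ (map proj₁ done) (here refl))))))
    ⇒V1 a (inj₁ (nk , inj₂ (inj₂ (inj₂ (inj₁ m))))) = nk , inj₂ (inj₂ (inj₂ (inj₁ (subst (a ∈_) (sym mp) (∈-++⁺ˡ m)))))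
    ⇒V1 a (inj₁ (nk , inj₁ x)) = nk , inj₁ x
    ⇒V1 a (inj₁ (nk , inj₂ (inj₁ x))) = nk , inj₂ (inj₁ x)
    ⇒V1 a (inj₁ (nk , inj₂ (inj₂ (inj₁ x)))) = nk , inj₂ (inj₂ (inj₁ x))
    ⇒V1 a (inj₁ (nk , inj₂ (inj₂ (inj₂ (inj₂ x))))) = nk , inj₂ (inj₂ (inj₂ (inj₂ x)))

    stellation-step : ∀ (Γ : Complex) → (∀ K → Γ K ⇔ Clique (V done) R0 K) → ∀ K → stellate (r ∷ q ∷ []) p Γ K ⇔ Clique V1 R1 K
    stellation-step Γ Γ⇔ K = mk⇔ (λ s → clique-mono (λ a v' → ⇒V1 a v') fR K (Equivalence.to (stellate⇔Clique K) s))
                      (λ c → Equivalence.from (stellate⇔Clique K) (clique-mono (λ a v1 → V1⇒ a v1) (λ a b va vb → gR a b (V1⇒ a va) (V1⇒ b vb)) K c))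
      where
      open Stellation (V done) R0 Γ Γ⇔ r q p Vr Vq ¬V Rrq (R-sym ((p , r) ∷ rest)) Rrefl
      fR : ∀ a b → V' a → V' b → R' a b → R1 a b
      fR a b (inj₂ refl) (inj₂ refl) _ = inj₁ (Kissing-irrefl p)
      fR a b (inj₂ refl) (inj₁ vb) r' = link⇒compatible b vb (R'-from-x r' (V≢x b vb))
      fR a b (inj₁ va) (inj₂ refl) r' = R-sym rest p a (link⇒compatible a va (R'-to-x r' (V≢x a va)))
      fR a b (inj₁ va) (inj₁ vb) r' = old-pair⇒ a b (R'-old r' (V≢x a va) (V≢x b vb))
      gR : ∀ a b → V' a → V' b → R1 a b → R' a b
      gR a b (inj₂ refl) (inj₂ refl) _ = inj₁ (refl , refl)
      gR a b (inj₂ refl) (inj₁ vb) r1 = inj₂ (inj₁ (refl , V≢x b vb , compatible⇒link b vb r1))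
      gR a b (inj₁ va) (inj₂ refl) r1 = inj₂ (inj₂ (inj₁ (V≢x a va , refl , compatible⇒link a va (R-sym rest a p r1))))
      gR a b (inj₁ va) (inj₁ vb) r1 = inj₂ (inj₂ (inj₂ (V≢x a va , V≢x b vb , old-pair⇐ a b r1)))

  run-phase : ∀ done rest → ps ≡ done ++ rest → ∀ Γ → (∀ K → Γ K ⇔ Clique (V done) (R rest) K)
        → ∀ K → foldl (λ Γ pr → stellate (proj₂ pr ∷ q ∷ []) (proj₁ pr) Γ) Γ rest K ⇔ Clique (V ps) (R []) K
  run-phase done [] e Γ h K = subst (λ z → Γ K ⇔ Clique (V z) (R []) K) (sym (trans e (++-identityʳ done))) (h K)
  run-phase done ((p , r) ∷ rest) e Γ h K =
    run-phase (done ∷ʳ (p , r)) rest (trans e (sym (∷ʳ-++ done (p , r) rest))) (stellate (r ∷ q ∷ []) p Γ)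
      (Step.stellation-step done p r rest e Γ h) K

allPairs-lift : ∀ {R : Path → Path → Set} {Q : Path × Path → Path × Path → Set} xs →
  (∀ x y → x ∈ xs → y ∈ xs → R (proj₁ x) (proj₁ y) → Q x y) → AllPairs R (map proj₁ xs) → AllPairs Q xs
allPairs-lift [] f AllPairs.[] = AllPairs.[]
allPairs-lift (x ∷ xs) f (h AllPairs.∷ t) =
  tabulate (λ {y} ym → f x y (here refl) (there ym) (lookup h (∈-map⁺ proj₁ ym))) AllPairs.∷
  allPairs-lift xs (λ a b am bm → f a b (there am) (there bm)) t

module Assembly (Λ : Shape) (c : Point) (sec : SECorner Λ c) (vint : Interior Λ (northWest c))
    (qW qN : Path)
    (okW : IsOnlyTurnPath Λ (northWest c) E qW)
    (okN : IsOnlyTurnPath Λ (northWest c) S qN)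
    (psW psN : List (Path × Path))
    (vlW : ValidListing Λ (northWest c) qW (eW (northWest c)) (Prec (eW (northWest c))) psW)
    (vlN : ValidListing Λ (northWest c) qN (eN (northWest c)) (λ p p' → Prec (eN (northWest c)) p' p) psN) where

  open Corner Λ c sec vint

  memW : ∀ p → p ∈ map proj₁ psW ⇔ (Supported Λ p × p ≢ qW × TurnsAt v p × HasEdge p (edgeInto E v))
  memW = proj₁ (proj₂ vlW)

  strsW : All (λ pr → Straightened v (proj₁ pr) (proj₂ pr)) psW
  strsW = proj₂ (proj₂ (proj₂ vlW))

  memN : ∀ p → p ∈ map proj₁ psN ⇔ (Supported Λ p × p ≢ qN × TurnsAt v p × HasEdge p (edgeInto S v))
  memN = proj₁ (proj₂ vlN)

  strsN : All (λ pr → Straightened v (proj₁ pr) (proj₂ pr)) psN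
  strsN = proj₂ (proj₂ (proj₂ vlN))

  module SideW = Side Λ c sec vint E qW okW psW memW strsW
  module SideN = Side Λ c sec vint S qN okN psN memN strsN

  -- The orders ≺_e of the statement make both listings ordered by `Before`;
  -- for the North listing the order is reversed, matching the reversed ≺_{e_N}.
  ordW : AllPairs (λ x y → SideW.Before (proj₁ x) (proj₁ y)) psW
  ordW = allPairs-lift psW (λ x y xm ym pr → SideW.Prec⇒EntersS (proj₁ x) (proj₁ y) (∈-map⁺ proj₁ xm) (∈-map⁺ proj₁ ym) pr) (proj₁ (proj₂ (proj₂ vlW)))

  ordN : AllPairs (λ x y → SideN.Before (proj₁ x) (proj₁ y)) psN
  ordN = allPairs-lift psN (λ x y xm ym pr → conv (SideN.Prec⇒EntersS (proj₁ y) (proj₁ x) (∈-map⁺ proj₁ ym) (∈-map⁺ proj₁ xm) pr)) (proj₁ (proj₂ (proj₂ vlN)))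
    where
    conv : ∀ {a b} → SideN.EntersS b a → SideN.Before a b
    conv (a₁ , a₂ , m , e1 , e2 , w) = a₂ , a₁ , m , e2 , e1 , sym w

  tW : TurnsAtEntering E v qW
  tW = proj₁ (proj₂ okW)

  tN : TurnsAtEntering S v qN
  tN = proj₁ (proj₂ okN)

  straightenedN-not-turning : ∀ y → y ∈ map proj₂ psN → ¬ TurnsAt v y
  straightenedN-not-turning y m with ∈-map⁻ proj₂ m
  ... | (p , r) , m' , refl = proj₂ (SideN.straightened-Ext p r m')

  listedW-entering : ∀ x → x ∈ map proj₁ psW → TurnsAtEntering E v x
  listedW-entering x m with SideW.p-shape x m
  ... | α , e1 , e2 = entering-intro E v x α [] e1 e2

  -- The two phases: during the West phase the North listing is untouched,
  -- during the North phase the West listing has been fully added.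
  module West = Phase Λ c sec vint E qW okW psW memW strsW (proj₁ vlW) ordW qN tN [] psN (λ x ()) straightenedN-not-turning
  module North = Phase Λ c sec vint S qN okN psN memN strsN (proj₁ vlN) ordN qW tW psW [] listedW-entering (λ y ())

  qW≢qN : qW ≢ qN
  qW≢qN e = turns-one-side E v qW tW (subst (TurnsAtEntering S v) (sym e) tN)

  qW-kiss-qN : Kissing qW qN
  qW-kiss-qN = kiss-intro E qW qN (opposite-turns-kiss E v qW qN tW tN)

  -- A path not turning at v is compatible with qW (qN) in the initial state:
  -- it either does not kiss it or is a West (North) straightening.
  apex-compatible : ∀ x → Ext x → ∀ y → y ≡ qW ⊎ y ≡ qN → West.R psW x y
  apex-compatible x ex y (inj₁ refl) with x ∈? map proj₂ psW
  ... | yes m = inj₂ (inj₁ (inj₂ (refl , m)))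
  ... | no nm = inj₁ (λ k → nm (∈-map⁺ proj₂ (proj₂ (SideW.kiss-q⇒straightened x ex (Kissing-sym x qW k)))))
  apex-compatible x ex y (inj₂ refl) with x ∈? map proj₂ psN
  ... | yes m = inj₂ (inj₂ (inj₂ (refl , m)))
  ... | no nm = inj₁ (λ k → nm (∈-map⁺ proj₂ (proj₂ (SideN.kiss-q⇒straightened x ex (Kissing-sym x qN k)))))

  Apex : List Path → Set
  Apex X = X ≡ [] ⊎ X ≡ qW ∷ [] ⊎ X ≡ qN ∷ []

  apex-member : ∀ X → Apex X → ∀ {x} → x ∈ X → x ≡ qW ⊎ x ≡ qN
  apex-member .(qW ∷ []) (inj₂ (inj₁ refl)) (here e) = inj₁ e
  apex-member .(qN ∷ []) (inj₂ (inj₂ refl)) (here e) = inj₂ e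
  apex-member .(qW ∷ []) (inj₂ (inj₁ refl)) (there ())
  apex-member .(qN ∷ []) (inj₂ (inj₂ refl)) (there ())

  apex-single : ∀ X → Apex X → ∀ {x y} → x ∈ X → y ∈ X → x ≡ y
  apex-single .(qW ∷ []) (inj₂ (inj₁ refl)) (here e) (here e') = trans e (sym e')
  apex-single .(qN ∷ []) (inj₂ (inj₂ refl)) (here e) (here e') = trans e (sym e')
  apex-single .(qW ∷ []) (inj₂ (inj₁ refl)) _ (there ())
  apex-single .(qN ∷ []) (inj₂ (inj₂ refl)) _ (there ())
  apex-single .(qW ∷ []) (inj₂ (inj₁ refl)) (there ()) _
  apex-single .(qN ∷ []) (inj₂ (inj₂ refl)) (there ()) _

  Γ₀⇒clique : ∀ K → Γ₀ Λ c qW qN K → Clique (West.V []) (West.R psW) K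
  Γ₀⇒clique K (G , (allG , nkG) , X , xc , mk) = tabulate vk , rk
    where
    cat : ∀ {x} → x ∈ K → (∃[ g ] (g ∈ G × Extends Λ v g x)) ⊎ x ∈ X
    cat {x} m = Equivalence.to (mk x) m
    Xq : ∀ {x} → x ∈ X → x ≡ qW ⊎ x ≡ qN
    Xq = apex-member X xc
    Xeq : ∀ {x y} → x ∈ X → y ∈ X → x ≡ y
    Xeq = apex-single X xc
    apex-NK : ∀ {x} → x ≡ qW ⊎ x ≡ qN → NKVertex Λ x
    apex-NK (inj₁ refl) = SideW.q-NK
    apex-NK (inj₂ refl) = SideN.q-NK
    extV : ∀ {x} → (∃[ g ] (g ∈ G × Extends Λ v g x)) → Ext x
    extV {x} (g , gm , ex) = ext-NK g x (lookup allG gm) ex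
    vk : ∀ {x} → x ∈ K → West.V [] x
    vk m with cat m
    ... | inj₁ e = proj₁ (extV e) , inj₁ (proj₂ (extV e))
    ... | inj₂ xm with Xq xm
    ... | inj₁ e = apex-NK (inj₁ e) , inj₂ (inj₁ e)
    ... | inj₂ e = apex-NK (inj₂ e) , inj₂ (inj₂ (inj₁ e))
    rk : ∀ a b → a ∈ K → b ∈ K → West.R psW a b
    rk a b am bm with cat am | cat bm
    ... | inj₁ (g , gm , ea) | inj₁ (g' , gm' , eb) = inj₁ (λ k → nkG g g' gm gm' (ext-kiss⇒ g g' a b (lookup allG gm) (lookup allG gm') ea eb k))
    ... | inj₁ ea | inj₂ xm = apex-compatible a (extV ea) b (Xq xm)
    ... | inj₂ xm | inj₁ eb = West.R-sym psW b a (apex-compatible b (extV eb) a (Xq xm))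
    ... | inj₂ xm | inj₂ xm' with Xeq xm xm'
    ... | refl = inj₁ (Kissing-irrefl a)

  V₀ : Path → Set
  V₀ = West.V []

  collect : (L : List Path) → All V₀ L → List Path
  collect [] [] = []
  collect (x ∷ L) ((nk , inj₁ nt) ∷ vs) = proj₁ (restrict-to-Λ∖c x nk nt) ∷ collect L vs
  collect (x ∷ L) ((nk , inj₂ _) ∷ vs) = collect L vs

  collect-sound : ∀ L vs {g} → g ∈ collect L vs → ∃[ x ] (x ∈ L × NKVertex Λc g × Extends Λ v g x)
  collect-sound (x ∷ L) ((nk , inj₁ nt) ∷ vs) (here refl) = x , here refl , proj₂ (restrict-to-Λ∖c x nk nt)
  collect-sound (x ∷ L) ((nk , inj₁ nt) ∷ vs) (there m) with collect-sound L vs m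
  ... | y , ym , r = y , there ym , r
  collect-sound (x ∷ L) ((nk , inj₂ _) ∷ vs) m with collect-sound L vs m
  ... | y , ym , r = y , there ym , r

  collect-complete : ∀ L vs {x} → x ∈ L → ¬ TurnsAt v x → ∃[ g ] (g ∈ collect L vs × Extends Λ v g x)
  collect-complete (x ∷ L) ((nk , inj₁ nt) ∷ vs) (here refl) _ = proj₁ (restrict-to-Λ∖c x nk nt) , here refl , proj₂ (proj₂ (restrict-to-Λ∖c x nk nt))
  collect-complete (x ∷ L) ((nk , inj₂ (inj₁ refl)) ∷ vs) (here refl) nt = ⊥-elim (nt (entering⇒turns E v qW tW))
  collect-complete (x ∷ L) ((nk , inj₂ (inj₂ (inj₁ refl))) ∷ vs) (here refl) nt = ⊥-elim (nt (entering⇒turns S v qN tN))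
  collect-complete (x ∷ L) ((nk , inj₂ (inj₂ (inj₂ (inj₁ ())))) ∷ vs) (here refl) nt
  collect-complete (x ∷ L) ((nk , inj₂ (inj₂ (inj₂ (inj₂ ())))) ∷ vs) (here refl) nt
  collect-complete (x ∷ L) ((nk , inj₁ _) ∷ vs) (there m) nt with collect-complete L vs m nt
  ... | g , gm , e = g , there gm , e
  collect-complete (x ∷ L) ((nk , inj₂ _) ∷ vs) (there m) nt = collect-complete L vs m nt

  ¬R-qW-qN : ¬ West.R psW qW qN
  ¬R-qW-qN (inj₁ nk) = nk qW-kiss-qN
  ¬R-qW-qN (inj₂ (inj₁ (inj₁ (_ , m)))) = West.straightening-not-turning qN m (entering⇒turns S v qN tN)
  ¬R-qW-qN (inj₂ (inj₁ (inj₂ (e , _)))) = qW≢qN (sym e)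
  ¬R-qW-qN (inj₂ (inj₂ (inj₁ (e , _)))) = qW≢qN e
  ¬R-qW-qN (inj₂ (inj₂ (inj₂ (_ , m)))) = straightenedN-not-turning qW m (entering⇒turns E v qW tW)

  -- A clique of the base flag complex is a face of Γ₀: its paths not turning
  -- at v are extensions of a face G of NK(λ ∖ c), and it contains at most one
  -- of qW, qN (the apex), as these kiss.
  module CliqueToΓ₀ (K : Face) (av : All V₀ K) (rr : ∀ a b → a ∈ K → b ∈ K → West.R psW a b) where

    G : Face
    G = collect K av

    G-NK : ∀ {g} → g ∈ G → NKVertex Λc g
    G-NK m = proj₁ (proj₂ (proj₂ (collect-sound K av m)))

    G-nokiss : ∀ g g' → g ∈ G → g' ∈ G → ¬ Kissing g g'
    G-nokiss g g' gm gm' k with collect-sound K av gm | collect-sound K av gm'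
    ... | x , xm , ng , ex | y , ym , ng' , ey with rr x y xm ym
    ... | inj₁ nk = nk (ext-kiss⇐ g g' x y ng ng' ex ey k)
    ... | inj₂ (inj₁ (inj₁ (refl , _))) = proj₂ (ext-NK g x ng ex) (entering⇒turns E v qW tW)
    ... | inj₂ (inj₁ (inj₂ (refl , _))) = proj₂ (ext-NK g' y ng' ey) (entering⇒turns E v qW tW)
    ... | inj₂ (inj₂ (inj₁ (refl , _))) = proj₂ (ext-NK g x ng ex) (entering⇒turns S v qN tN)
    ... | inj₂ (inj₂ (inj₂ (refl , _))) = proj₂ (ext-NK g' y ng' ey) (entering⇒turns S v qN tN)

    not-turning : ∀ {x} → x ∈ K → x ≢ qW → x ≢ qN → ¬ TurnsAt v x
    not-turning m n1 n2 with lookup av m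
    ... | _ , inj₁ nt = nt
    ... | _ , inj₂ (inj₁ e) = ⊥-elim (n1 e)
    ... | _ , inj₂ (inj₂ (inj₁ e)) = ⊥-elim (n2 e)
    ... | _ , inj₂ (inj₂ (inj₂ (inj₁ ())))
    ... | _ , inj₂ (inj₂ (inj₂ (inj₂ ())))

    SplitsWith : Face → Set
    SplitsWith X = Apex X × (∀ x → x ∈ K ⇔ ((∃[ g ] (g ∈ G × Extends Λ v g x)) ⊎ x ∈ X))

    splits-with : ∀ X → Apex X → (∀ z → z ∈ X → z ∈ K) → (qW ∈ K → qW ∈ X) → (qN ∈ K → qN ∈ X) → SplitsWith X
    splits-with X xc X⊆ qW∈ qN∈ = xc , λ z → mk⇔ (t z) (f z)
      where
      t : ∀ z → z ∈ K → (∃[ g ] (g ∈ G × Extends Λ v g z)) ⊎ z ∈ X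
      t z zm with z ≟Path qW | z ≟Path qN
      ... | yes refl | _ = inj₂ (qW∈ zm)
      ... | no _ | yes refl = inj₂ (qN∈ zm)
      ... | no n1 | no n2 = inj₁ (collect-complete K av zm (not-turning zm n1 n2))
      f : ∀ z → (∃[ g ] (g ∈ G × Extends Λ v g z)) ⊎ z ∈ X → z ∈ K
      f z (inj₂ m) = X⊆ z m
      f z (inj₁ (g , gm , ez)) with collect-sound K av gm
      ... | x , xm , ng , ex with ext-unique g z x ng ez ex
      ... | refl = xm

    apex : ∃[ X ] SplitsWith X
    apex with qW ∈? K | qN ∈? K
    ... | yes wm | yes nm = ⊥-elim (¬R-qW-qN (rr qW qN wm nm))
    ... | yes wm | no nn = qW ∷ [] , splits-with (qW ∷ []) (inj₂ (inj₁ refl)) (λ { z (here refl) → wm ; z (there ()) }) (λ _ → here refl) (λ m → ⊥-elim (nn m))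
    ... | no nw | yes nm = qN ∷ [] , splits-with (qN ∷ []) (inj₂ (inj₂ refl)) (λ { z (here refl) → nm ; z (there ()) }) (λ m → ⊥-elim (nw m)) (λ _ → here refl)
    ... | no nw | no nn = [] , splits-with [] (inj₁ refl) (λ z ()) (λ m → ⊥-elim (nw m)) (λ m → ⊥-elim (nn m))

  clique⇒Γ₀ : ∀ K → Clique (West.V []) (West.R psW) K → Γ₀ Λ c qW qN K
  clique⇒Γ₀ K (av , rr) = G , (tabulate G-NK , G-nokiss) , apex
    where open CliqueToΓ₀ K av rr

  Γ₀⇔clique : ∀ K → Γ₀ Λ c qW qN K ⇔ Clique (West.V []) (West.R psW) K
  Γ₀⇔clique K = mk⇔ (Γ₀⇒clique K) (clique⇒Γ₀ K)

  ΓW : Complex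
  ΓW = foldl (λ Γ pr → stellate (proj₂ pr ∷ qW ∷ []) (proj₁ pr) Γ) (Γ₀ Λ c qW qN) psW

  -- The state reached by the West phase is the initial state of the North
  -- phase, the roles of the two listings being exchanged.
  V-west⇒north : ∀ x → West.V psW x → North.V [] x
  V-west⇒north x (nk , inj₁ a) = nk , inj₁ a
  V-west⇒north x (nk , inj₂ (inj₁ a)) = nk , inj₂ (inj₂ (inj₁ a))
  V-west⇒north x (nk , inj₂ (inj₂ (inj₁ a))) = nk , inj₂ (inj₁ a)
  V-west⇒north x (nk , inj₂ (inj₂ (inj₂ (inj₁ a)))) = nk , inj₂ (inj₂ (inj₂ (inj₂ a)))
  V-west⇒north x (nk , inj₂ (inj₂ (inj₂ (inj₂ ()))))

  V-north⇒west : ∀ x → North.V [] x → West.V psW x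
  V-north⇒west x (nk , inj₁ a) = nk , inj₁ a
  V-north⇒west x (nk , inj₂ (inj₁ a)) = nk , inj₂ (inj₂ (inj₁ a))
  V-north⇒west x (nk , inj₂ (inj₂ (inj₁ a))) = nk , inj₂ (inj₁ a)
  V-north⇒west x (nk , inj₂ (inj₂ (inj₂ (inj₁ ()))))
  V-north⇒west x (nk , inj₂ (inj₂ (inj₂ (inj₂ a)))) = nk , inj₂ (inj₂ (inj₂ (inj₁ a)))

  R-west⇒north : ∀ x y → West.R [] x y → North.R psN x y
  R-west⇒north x y (inj₁ a) = inj₁ a
  R-west⇒north x y (inj₂ (inj₁ (inj₁ (_ , ()))))
  R-west⇒north x y (inj₂ (inj₁ (inj₂ (_ , ()))))
  R-west⇒north x y (inj₂ (inj₂ a)) = inj₂ (inj₁ a)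

  R-north⇒west : ∀ x y → North.R psN x y → West.R [] x y
  R-north⇒west x y (inj₁ a) = inj₁ a
  R-north⇒west x y (inj₂ (inj₁ a)) = inj₂ (inj₂ a)
  R-north⇒west x y (inj₂ (inj₂ (inj₁ (_ , ()))))
  R-north⇒west x y (inj₂ (inj₂ (inj₂ (_ , ()))))

  west⇔north : ∀ K → Clique (West.V psW) (West.R []) K ⇔ Clique (North.V []) (North.R psN) K
  west⇔north K = mk⇔ (clique-mono V-west⇒north (λ a b _ _ → R-west⇒north a b) K) (clique-mono V-north⇒west (λ a b _ _ → R-north⇒west a b) K)

  hasEdge : ∀ dd x a b → steps x ≡ a ++ dd ∷ b → walk (start x) (a ∷ʳ dd) ≡ v → HasEdge x (edgeInto dd v)
  hasEdge dd x a b e w = a , dd , b , e , step-into-v (walk (start x) a) dd (trans (sym (walk-∷ʳ (start x) a dd)) w) ,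
                          trans (edgeInto-step dd) (sym (edgeInto-target dd v))

  -- Every NK-vertex of Λ either does not turn at v, or is qW or qN, or is
  -- listed: a path turning at v enters v through eW or eN.
  classify : ∀ x → NKVertex Λ x → North.V psN x
  classify x nk with x ≟Path qN | x ≟Path qW | x ∈? map proj₁ psN | x ∈? map proj₁ psW
  ... | yes e | _ | _ | _ = nk , inj₂ (inj₁ e)
  ... | no _ | yes e | _ | _ = nk , inj₂ (inj₂ (inj₁ e))
  ... | no _ | no _ | yes m | _ = nk , inj₂ (inj₂ (inj₂ (inj₁ m)))
  ... | no _ | no _ | no _ | yes m = nk , inj₂ (inj₂ (inj₂ (inj₂ m)))
  ... | no nN | no nW | no mN | no mW = nk , inj₁ nt
    where
    nt : ¬ TurnsAt v x
    nt t with turns-elim v x t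
    ... | E , a , b , e , w = mW (Equivalence.from (memW x) (proj₁ nk , nW , t , hasEdge E x a (S ∷ b) e w))
    ... | S , a , b , e , w = mN (Equivalence.from (memN x) (proj₁ nk , nN , t , hasEdge S x a (E ∷ b) e w))

  R-final⇒nokiss : ∀ x y → North.R [] x y → ¬ Kissing x y
  R-final⇒nokiss x y (inj₁ a) = a
  R-final⇒nokiss x y (inj₂ (inj₁ (inj₁ (_ , ()))))
  R-final⇒nokiss x y (inj₂ (inj₁ (inj₂ (_ , ()))))
  R-final⇒nokiss x y (inj₂ (inj₂ (inj₁ (_ , ()))))
  R-final⇒nokiss x y (inj₂ (inj₂ (inj₂ (_ , ()))))

  clique⇔NK : ∀ K → Clique (North.V psN) (North.R []) K ⇔ NK Λ K
  clique⇔NK K = mk⇔ (clique-mono (λ a va → proj₁ va) (λ a b _ _ → R-final⇒nokiss a b) K)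
                    (clique-mono classify (λ a b _ _ nk → inj₁ nk) K)

theorem4p1 : (Λ : Shape) (c : Point) → SECorner Λ c → Interior Λ (northWest c)
    → (qW qN : Path)
    → IsOnlyTurnPath Λ (northWest c) E qW
    → IsOnlyTurnPath Λ (northWest c) S qN
    → (psW psN : List (Path × Path))
    → ValidListing Λ (northWest c) qW (eW (northWest c)) (Prec (eW (northWest c))) psW
    → ValidListing Λ (northWest c) qN (eN (northWest c)) (λ p p' → Prec (eN (northWest c)) p' p) psN
    → ∀ K → (Γfinal Λ c qW qN psW psN K ⇔ NK Λ K)
theorem4p1 Λ c sec vint qW qN okW okN psW psN vlW vlN K =
  clique⇔NK K ⇔-∘ North.run-phase [] psN refl ΓW afterWest K
  where
  open Assembly Λ c sec vint qW qN okW okN psW psN vlW vlN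

  afterWest : ∀ K → ΓW K ⇔ Clique (North.V []) (North.R psN) K
  afterWest K = west⇔north K ⇔-∘ West.run-phase [] psW refl (Γ₀ Λ c qW qN) Γ₀⇔clique K
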